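{- For every positive integer $n$, the polynomial $\widetilde{A}_n(p,q)$ is palindromic of darga $\lfloor n/2\rfloor$; that is, writing $m=\lfloor n/2\rfloor$, $$\widetilde{A}_n(p,q)=\widetilde{A}_n(q,p)\qquad\text{and}\qquad \widetilde{A}_n(p,q)=(pq)^{m}\,\widetilde{A}_n(1/p,1/q).$$
   Context: Let $\mathfrak{S}_n$ denote the set of permutations $\pi=\pi_1\pi_2\cdots\pi_n$ of $[n]=\{1,\dots,n\}$. An index $i\in[n-1]$ is a descent of $\pi$ if $\pi_i>\pi_{i+1}$; it is an odd descent if moreover $i$ is odd, and an even descent if moreover $i$ is even. Let $\mathrm{odes}(\pi)$ and $\mathrm{edes}(\pi)$ denote the number of odd descents and even descents of $\pi$, respectively. Define $$A_n(p,q)=\sum_{\pi\in\mathfrak{S}_n}p^{\mathrm{odes}(\pi)}q^{\mathrm{edes}(\pi)},$$ and set $\widetilde{A}_n(p,q)=A_n(p,q)$ if $n$ is odd and $\widetilde{A}_n(p,q)=(1+q)A_n(p,q)$ if $n$ is even. A nonzero bivariate polynomial $f(p,q)$ is called palindromic of darga $m$ if $f(p,q)=f(q,p)$ and $f(p,q)=(pq)^m f(1/p,1/q)$. -}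

module Defs where

open import Data.Nat using (ℕ; zero; suc; _+_; _∸_; _≤_; _<_; _<ᵇ_; _≟_; _/_)
open import Data.Bool using (Bool; true; false; if_then_else_)
open import Data.List using (List; []; _∷_; map; concatMap; filter; length; applyUpTo)
open import Data.Product using (_×_; ∃₂)
open import Data.Sum using (_⊎_)
open import Relation.Nullary using (¬_)
open import Relation.Nullary.Decidable using (_×-dec_)
open import Relation.Binary.PropositionalEquality using (_≡_; _≢_)
import Data.List.Relation.Unary.Unique.DecPropositional as UDec

range : ℕ → List ℕ
range n = applyUpTo suc n

words : List ℕ → ℕ → List (List ℕ)
words xs zero    = [] ∷ []
words xs (suc k) = concatMap (λ w → map (λ x → x ∷ w) xs) (words xs k)

-- 𝔖_n : permutations π = π₁π₂⋯πₙ of [n] in one-line notation,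
-- i.e. the words of length n over [n] with pairwise distinct letters
Sym : ℕ → List (List ℕ)
Sym n = filter (UDec.unique? _≟_) (words (range n) n)

isOdd : ℕ → Bool
isOdd zero          = false
isOdd (suc zero)    = true
isOdd (suc (suc k)) = isOdd k

-- descents of a word, as 1-based positions; the argument k is the
-- position of the head of the word
descentsFrom : ℕ → List ℕ → List ℕ
descentsFrom k []            = []
descentsFrom k (a ∷ [])      = []
descentsFrom k (a ∷ b ∷ w) =
  if b <ᵇ a then k ∷ descentsFrom (suc k) (b ∷ w)
  else descentsFrom (suc k) (b ∷ w)

Des : List ℕ → List ℕ
Des π = descentsFrom 1 π

countOdd : List ℕ → ℕ
countOdd [] = 0
countOdd (x ∷ xs) = if isOdd x then suc (countOdd xs) else countOdd xs

countEven : List ℕ → ℕ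
countEven [] = 0
countEven (x ∷ xs) = if isOdd x then countEven xs else suc (countEven xs)

odes : List ℕ → ℕ
odes π = countOdd (Des π)

edes : List ℕ → ℕ
edes π = countEven (Des π)

-- Bivariate polynomials in p, q with natural-number coefficients are
-- represented by their coefficient function: f i j = [p^i q^j] f
-- (finitely supported in all uses below).
Poly₂ : Set
Poly₂ = ℕ → ℕ → ℕ

-- A_n(p,q) = Σ_{π ∈ 𝔖_n} p^{odes π} q^{edes π};
-- the coefficient of p^i q^j is #{π ∈ 𝔖_n : odes π = i, edes π = j}
A : ℕ → Poly₂
A n i j = length (filter (λ π → (odes π ≟ i) ×-dec (edes π ≟ j)) (Sym n))

onePlusQ : Poly₂ → Poly₂
onePlusQ f i zero    = f i zero
onePlusQ f i (suc j) = f i (suc j) + f i j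

Ã : ℕ → Poly₂
Ã n = if isOdd n then A n else onePlusQ (A n)

-- f is palindromic of darga m:
--   f ≠ 0,  f(p,q) = f(q,p),  and  f(p,q) = (pq)^m f(1/p,1/q).
-- The last identity of Laurent polynomials, read coefficientwise, says
--   [p^i q^j] f = [p^{m-i} q^{m-j}] f  for all integers i, j
-- (coefficients at negative exponents being 0); for i, j ∈ ℕ this is:
--   if i ≤ m and j ≤ m then f i j = f (m-i) (m-j), otherwise f i j = 0.
Palindromic : ℕ → Poly₂ → Set
Palindromic m f =
  (∃₂ λ i j → f i j ≢ 0) ×
  (∀ i j → f i j ≡ f j i) ×
  (∀ i j → i ≤ m → j ≤ m → f i j ≡ f (m ∸ i) (m ∸ j)) ×
  (∀ i j → (m < i ⊎ m < j) → f i j ≡ 0)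

-- Record each permutation π of [n] by the pair (odes π , edes π), so that A_n is the generating
-- function of this multiset of pairs. The complement π ↦ n + 1 - π turns descents into ascents, so the
-- pairs of π and of its complement add up to the numbers of odd and of even positions in [n - 1]; this
-- is the reciprocity (pq)^m A_n(1/p, 1/q) = A_n(p, q), the factor 1 + q supplying the missing even
-- position when n is even. For odd n, the reverse of the complement has its descents at the positions
-- n - i, i a descent of π, and these have the other parity; hence A_n(p, q) = A_n(q, p).
-- For even n, split the permutations of [n] at their maximum: the two pieces have lengths k and
-- n - 1 - k, and cutting the descent word there realises each pair of smaller permutations exactly
-- binomial(n - 1, k) times. For 0 < k < n - 1 one piece has odd and the other even length, so 1 + q can
-- be carried by the even piece, symmetric by induction, and exchanging p and q then maps the term for k
-- onto the term for n - 1 - k; the terms for k = 0 and k = n - 1 only involve A_{n-1}, with n - 1 odd.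

module Submission where

open import Defs

open import Data.Bool using (Bool; true; false; if_then_else_; not)
open import Data.Bool.Properties using (not-involutive)
open import Data.Empty using (⊥-elim)
open import Data.List using (List; []; _∷_; [_]; _++_; _∷ʳ_; map; concatMap; filter; length; applyUpTo; applyDownFrom; upTo; take; drop; reverse; replicate; cartesianProductWith; cartesianProduct)
open import Data.List.Properties using (unfold-reverse; length-reverse; length-++; length-map; take++drop≡id; map-++; ++-assoc; ++-identityʳ; map-∘; map-cong; map-id; concatMap-++; concatMap-map; map-concatMap; concatMap-cong; cartesianProductWith-distribʳ-++; reverse-applyUpTo; map-applyUpTo; map-upTo; reverse-map; reverse-involutive; applyUpTo-∷ʳ; filter-≐; filter-++; filter-none)
open import Data.List.Membership.Propositional using (_∈_)
open import Data.List.Membership.Propositional.Properties using (∈-map⁺; ∈-map⁻; ∈-filter⁺; ∈-filter⁻; ∈-applyUpTo⁺; ∈-applyUpTo⁻; ∈-cartesianProductWith⁺; ∈-cartesianProductWith⁻; ∈-∃++; ∈-upTo⁺; ∈-upTo⁻; ∈-length; ∈-++⁺ˡ)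
open import Data.List.Membership.Propositional.Properties.WithK using (unique∧set⇒bag)
open import Data.List.Relation.Binary.BagAndSetEquality using (∼bag⇒↭)
open import Data.List.Relation.Binary.Permutation.Propositional using (_↭_; ↭-refl; ↭-sym; ↭-trans; ↭-reflexive; ↭⇒↭ₛ; module PermutationReasoning) renaming (refl to ↭-refl′; prep to ↭-prep′; swap to ↭-swap′; trans to ↭-trans′)
open import Data.List.Relation.Binary.Permutation.Propositional.Properties using (++⁺; ++⁺ˡ; ++⁺ʳ; ++-comm; shifts; shift; All-resp-↭; filter-↭; ↭-reverse; ↭-length; map⁺)
import Data.List.Relation.Binary.Permutation.Setoid.Properties
open import Data.List.Relation.Unary.All as All using (All; []; _∷_)
import Data.List.Relation.Unary.All.Properties as AllP
open import Data.List.Relation.Unary.AllPairs using ([]; _∷_)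
open import Data.List.Relation.Unary.Any using (here)
open import Data.List.Relation.Unary.Unique.Propositional using (Unique)
import Data.List.Relation.Unary.Unique.Propositional.Properties as Unique
import Data.List.Relation.Unary.Unique.DecPropositional as UDec
open import Data.Nat using (ℕ; zero; suc; pred; _/_; _+_; _∸_; _≤_; _<_; z≤n; s≤s; _<ᵇ_; _≟_)
open import Data.List.Membership.DecPropositional _≟_ using (_∈?_)
open import Data.Nat.DivMod using (m/n≡1+[m∸n]/n)
open import Data.Nat.Induction using (<-rec)
open import Data.Nat.Properties using (+-identityʳ; +-comm; +-assoc; +-suc; suc-injective; <-irrefl; ≤-refl; ≤-trans; ≤-pred; ≤∧≢⇒<; 1+n≰n; m≤n⇒m≤1+n; m<m+n; m≤m+n; +-monoʳ-<; m+[n∸m]≡n; m∸n≤m; +-∸-assoc; m∸[m∸n]≡n; m+n∸m≡n; _<?_; <⇒≱; ≮⇒≥; +-mono-≤; n∸n≡0; <-trans; n<1+n; <⇒≤; <-cmp; ∸-monoʳ-<; ∸-monoʳ-≤)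
open import Data.Product using (Σ; ∃; _×_; _,_; proj₁; proj₂; swap)
open import Data.Product.Properties using (≡-dec)
open import Data.Sum using (_⊎_; inj₁; inj₂)
open import Function using (_∘_; id)
open import Function.Bundles using (_⇔_; mk⇔; Equivalence)
open import Relation.Binary.Definitions using (DecidableEquality; tri<; tri≈; tri>)
open import Relation.Binary.PropositionalEquality using (_≡_; _≢_; setoid; refl; sym; trans; cong; cong₂; subst; subst₂; module ≡-Reasoning)
open import Relation.Nullary using (yes; no; does)
open import Relation.Nullary.Decidable using (_×-dec_)
open import Relation.Unary using (Decidable; _≐_)

module SetoidPermutation {A : Set} = Data.List.Relation.Binary.Permutation.Setoid.Properties (setoid A)

-- Lists as multisets

module _ {A B : Set} where

  concatMap-cong-All : {f g : A → List B} {xs : List A} →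
                       All (λ x → f x ≡ g x) xs → concatMap f xs ≡ concatMap g xs
  concatMap-cong-All []       = refl
  concatMap-cong-All (e ∷ es) = cong₂ _++_ e (concatMap-cong-All es)

  concatMap-↭ : {f g : A → List B} {xs : List A} →
                All (λ x → f x ↭ g x) xs → concatMap f xs ↭ concatMap g xs
  concatMap-↭ []       = ↭-refl
  concatMap-↭ (p ∷ ps) = ++⁺ p (concatMap-↭ ps)

  concatMap⁺ : (f : A → List B) {xs ys : List A} → xs ↭ ys → concatMap f xs ↭ concatMap f ys
  concatMap⁺ f ↭-refl′             = ↭-refl
  concatMap⁺ f (↭-prep′ x p)       = ++⁺ˡ (f x) (concatMap⁺ f p)
  concatMap⁺ f (↭-swap′ x y p)     = ↭-trans (shifts (f x) (f y)) (++⁺ˡ (f y) (++⁺ˡ (f x) (concatMap⁺ f p)))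
  concatMap⁺ f (↭-trans′ p q)      = ↭-trans (concatMap⁺ f p) (concatMap⁺ f q)

  concatMap-[] : (xs : List A) → concatMap {B = B} (λ _ → []) xs ≡ []
  concatMap-[] []       = refl
  concatMap-[] (x ∷ xs) = concatMap-[] xs

  concatMap-singleton : (f : A → B) (xs : List A) → concatMap (λ x → [ f x ]) xs ≡ map f xs
  concatMap-singleton f []       = refl
  concatMap-singleton f (x ∷ xs) = cong (f x ∷_) (concatMap-singleton f xs)

  concatMap-split : (f g : A → List B) (xs : List A) →
                    concatMap (λ x → f x ++ g x) xs ↭ concatMap f xs ++ concatMap g xs
  concatMap-split f g []       = ↭-refl
  concatMap-split f g (x ∷ xs) = begin
    (f x ++ g x) ++ concatMap (λ x → f x ++ g x) xs  ≡⟨ ++-assoc (f x) (g x) _ ⟩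
    f x ++ g x ++ concatMap (λ x → f x ++ g x) xs    ↭⟨ ++⁺ˡ (f x) (++⁺ˡ (g x) (concatMap-split f g xs)) ⟩
    f x ++ g x ++ concatMap f xs ++ concatMap g xs   ↭⟨ ++⁺ˡ (f x) (shifts (g x) (concatMap f xs)) ⟩
    f x ++ concatMap f xs ++ g x ++ concatMap g xs   ≡⟨ ++-assoc (f x) (concatMap f xs) _ ⟨
    (f x ++ concatMap f xs) ++ g x ++ concatMap g xs ∎
    where open PermutationReasoning

module _ {A B C : Set} where

  concatMap-comm : (h : A → B → List C) (xs : List A) (ys : List B) →
                   concatMap (λ x → concatMap (h x) ys) xs ↭ concatMap (λ y → concatMap (λ x → h x y) xs) ys
  concatMap-comm h []       ys = ↭-reflexive (sym (concatMap-[] ys))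
  concatMap-comm h (x ∷ xs) ys = ↭-trans (++⁺ˡ (concatMap (h x) ys) (concatMap-comm h xs ys))
                                         (↭-sym (concatMap-split (h x) (λ y → concatMap (λ x → h x y) xs) ys))

copies : {A : Set} → ℕ → List A → List A
copies zero    xs = []
copies (suc c) xs = xs ++ copies c xs

module _ {A : Set} where

  copies-+ : (a b : ℕ) (xs : List A) → copies (a + b) xs ≡ copies a xs ++ copies b xs
  copies-+ zero    b xs = refl
  copies-+ (suc a) b xs = trans (cong (xs ++_) (copies-+ a b xs)) (sym (++-assoc xs _ _))

  copies⁺ : (c : ℕ) {xs ys : List A} → xs ↭ ys → copies c xs ↭ copies c ys
  copies⁺ zero    p = ↭-refl
  copies⁺ (suc c) p = ++⁺ p (copies⁺ c p)

  copies-++ : (c : ℕ) (xs ys : List A) → copies c (xs ++ ys) ↭ copies c xs ++ copies c ys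
  copies-++ zero    xs ys = ↭-refl
  copies-++ (suc c) xs ys = begin
    (xs ++ ys) ++ copies c (xs ++ ys)          ≡⟨ ++-assoc xs ys _ ⟩
    xs ++ ys ++ copies c (xs ++ ys)            ↭⟨ ++⁺ˡ xs (++⁺ˡ ys (copies-++ c xs ys)) ⟩
    xs ++ ys ++ copies c xs ++ copies c ys     ↭⟨ ++⁺ˡ xs (shifts ys (copies c xs)) ⟩
    xs ++ copies c xs ++ ys ++ copies c ys     ≡⟨ ++-assoc xs (copies c xs) _ ⟨
    (xs ++ copies c xs) ++ ys ++ copies c ys   ∎
    where open PermutationReasoning

concatMap-copies : {A B : Set} (f : A → List B) (c : ℕ) (xs : List A) → concatMap f (copies c xs) ≡ copies c (concatMap f xs)
concatMap-copies f zero    xs = refl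
concatMap-copies f (suc c) xs = trans (concatMap-++ f xs _) (cong (concatMap f xs ++_) (concatMap-copies f c xs))

map-copies : {A B : Set} (f : A → B) (c : ℕ) (xs : List A) → map f (copies c xs) ≡ copies c (map f xs)
map-copies f zero    xs = refl
map-copies f (suc c) xs = trans (map-++ f xs _) (cong (map f xs ++_) (map-copies f c xs))

cartesianProductWith-concatMap : {A B C : Set} (f : A → B → C) (xs : List A) (ys : List B) →
  cartesianProductWith f xs ys ≡ concatMap (λ x → map (f x) ys) xs
cartesianProductWith-concatMap f []       ys = refl
cartesianProductWith-concatMap f (x ∷ xs) ys = cong (map (f x) ys ++_) (cartesianProductWith-concatMap f xs ys)

module _ {A B C : Set} where

  cartesianProductWith-comm : (f : A → B → C) (xs : List A) (ys : List B) →
    cartesianProductWith f xs ys ↭ cartesianProductWith (λ y x → f x y) ys xs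
  cartesianProductWith-comm f xs ys = begin
    cartesianProductWith f xs ys                                ≡⟨ cartesianProductWith-concatMap f xs ys ⟩
    concatMap (λ x → map (f x) ys) xs                           ≡⟨ concatMap-cong (λ x → concatMap-singleton (f x) ys) xs ⟨
    concatMap (λ x → concatMap (λ y → [ f x y ]) ys) xs         ↭⟨ concatMap-comm (λ x y → [ f x y ]) xs ys ⟩
    concatMap (λ y → concatMap (λ x → [ f x y ]) xs) ys         ≡⟨ concatMap-cong (λ y → concatMap-singleton (λ x → f x y) xs) ys ⟩
    concatMap (λ y → map (λ x → f x y) xs) ys                   ≡⟨ cartesianProductWith-concatMap (λ y x → f x y) ys xs ⟨
    cartesianProductWith (λ y x → f x y) ys xs                  ∎
    where open PermutationReasoning

  cartesianProductWith⁺ˡ : (f : A → B → C) {xs xs′ : List A} (ys : List B) → xs ↭ xs′ →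
    cartesianProductWith f xs ys ↭ cartesianProductWith f xs′ ys
  cartesianProductWith⁺ˡ f {xs} {xs′} ys p = begin
    cartesianProductWith f xs ys        ≡⟨ cartesianProductWith-concatMap f xs ys ⟩
    concatMap (λ x → map (f x) ys) xs   ↭⟨ concatMap⁺ (λ x → map (f x) ys) p ⟩
    concatMap (λ x → map (f x) ys) xs′  ≡⟨ cartesianProductWith-concatMap f xs′ ys ⟨
    cartesianProductWith f xs′ ys       ∎
    where open PermutationReasoning

  cartesianProductWith⁺ʳ : (f : A → B → C) (xs : List A) {ys ys′ : List B} → ys ↭ ys′ →
    cartesianProductWith f xs ys ↭ cartesianProductWith f xs ys′
  cartesianProductWith⁺ʳ f []       p = ↭-refl
  cartesianProductWith⁺ʳ f (x ∷ xs) p = ++⁺ (map⁺ (f x) p) (cartesianProductWith⁺ʳ f xs p)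

  cartesianProductWith-cong : {f g : A → B → C} (xs : List A) (ys : List B) → (∀ x y → f x y ≡ g x y) →
    cartesianProductWith f xs ys ≡ cartesianProductWith g xs ys
  cartesianProductWith-cong []       ys e = refl
  cartesianProductWith-cong (x ∷ xs) ys e = cong₂ _++_ (map-cong (e x) ys) (cartesianProductWith-cong xs ys e)

  cartesianProductWith-distribˡ-++ : (f : A → B → C) (xs : List A) (ys ys′ : List B) →
    cartesianProductWith f xs (ys ++ ys′) ↭ cartesianProductWith f xs ys ++ cartesianProductWith f xs ys′
  cartesianProductWith-distribˡ-++ f xs ys ys′ = begin
    cartesianProductWith f xs (ys ++ ys′)
      ≡⟨ cartesianProductWith-concatMap f xs _ ⟩
    concatMap (λ x → map (f x) (ys ++ ys′)) xs
      ≡⟨ concatMap-cong (λ x → map-++ (f x) ys ys′) xs ⟩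
    concatMap (λ x → map (f x) ys ++ map (f x) ys′) xs
      ↭⟨ concatMap-split (λ x → map (f x) ys) (λ x → map (f x) ys′) xs ⟩
    concatMap (λ x → map (f x) ys) xs ++ concatMap (λ x → map (f x) ys′) xs
      ≡⟨ cong₂ _++_ (cartesianProductWith-concatMap f xs ys) (cartesianProductWith-concatMap f xs ys′) ⟨
    cartesianProductWith f xs ys ++ cartesianProductWith f xs ys′ ∎
    where open PermutationReasoning

module _ {A B C D : Set} where

  map-cartesianProductWith : (g : C → D) (f : A → B → C) (xs : List A) (ys : List B) →
    map g (cartesianProductWith f xs ys) ≡ cartesianProductWith (λ x y → g (f x y)) xs ys
  map-cartesianProductWith g f []       ys = refl
  map-cartesianProductWith g f (x ∷ xs) ys =
    trans (map-++ g (map (f x) ys) _) (cong₂ _++_ (sym (map-∘ ys)) (map-cartesianProductWith g f xs ys))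

  cartesianProductWith-mapˡ : (f : A → B → C) (h : D → A) (xs : List D) (ys : List B) →
    cartesianProductWith f (map h xs) ys ≡ cartesianProductWith (f ∘ h) xs ys
  cartesianProductWith-mapˡ f h []       ys = refl
  cartesianProductWith-mapˡ f h (x ∷ xs) ys = cong (map (f (h x)) ys ++_) (cartesianProductWith-mapˡ f h xs ys)

  cartesianProductWith-mapʳ : (f : A → B → C) (h : D → B) (xs : List A) (ys : List D) →
    cartesianProductWith f xs (map h ys) ≡ cartesianProductWith (λ x y → f x (h y)) xs ys
  cartesianProductWith-mapʳ f h []       ys = refl
  cartesianProductWith-mapʳ f h (x ∷ xs) ys = cong₂ _++_ (sym (map-∘ ys)) (cartesianProductWith-mapʳ f h xs ys)

upTo-< : ∀ n → All (_< n) (upTo n)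
upTo-< n = AllP.applyUpTo⁺₁ id n id

applyUpTo-+ : {A : Set} (f : ℕ → A) (a b : ℕ) → applyUpTo f (a + b) ≡ applyUpTo f a ++ applyUpTo (f ∘ (a +_)) b
applyUpTo-+ f zero    b = refl
applyUpTo-+ f (suc a) b = cong (f 0 ∷_) (applyUpTo-+ (f ∘ suc) a b)

applyDownFrom≡applyUpTo : {A : Set} (f : ℕ → A) (n : ℕ) → applyDownFrom f n ≡ applyUpTo (λ i → f (n ∸ suc i)) n
applyDownFrom≡applyUpTo f zero    = refl
applyDownFrom≡applyUpTo f (suc n) = cong (f n ∷_) (applyDownFrom≡applyUpTo f n)

map-cong-All : {A B : Set} {f g : A → B} {xs : List A} → All (λ x → f x ≡ g x) xs → map f xs ≡ map g xs
map-cong-All []       = refl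
map-cong-All (e ∷ es) = cong₂ _∷_ e (map-cong-All es)

cartesianProductWith-cong-All : {A B C : Set} {f g : A → B → C} {xs : List A} {ys : List B} →
  All (λ x → All (λ y → f x y ≡ g x y) ys) xs → cartesianProductWith f xs ys ≡ cartesianProductWith g xs ys
cartesianProductWith-cong-All []       = refl
cartesianProductWith-cong-All (e ∷ es) = cong₂ _++_ (map-cong-All e) (cartesianProductWith-cong-All es)

-- Counting positions by parity

-- (number of odd descents, number of even descents); (i , j) stands for the monomial p^i q^j.
Stat : Set
Stat = ℕ × ℕ

infixr 6 _⊕_

_⊕_ : Stat → Stat → Stat
x ⊕ y = proj₁ x + proj₁ y , proj₂ x + proj₂ y

⊕-identityʳ : (x : Stat) → x ⊕ (0 , 0) ≡ x
⊕-identityʳ (a , b) = cong₂ _,_ (+-identityʳ a) (+-identityʳ b)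

⊕-comm : (x y : Stat) → x ⊕ y ≡ y ⊕ x
⊕-comm (a , b) (c , d) = cong₂ _,_ (+-comm a c) (+-comm b d)

⊕-assoc : (x y z : Stat) → (x ⊕ y) ⊕ z ≡ x ⊕ (y ⊕ z)
⊕-assoc (a , b) (c , d) (e , f) = cong₂ _,_ (+-assoc a c e) (+-assoc b d f)

⊕-middle : (x y z : Stat) → x ⊕ (y ⊕ z) ≡ y ⊕ (x ⊕ z)
⊕-middle x y z = trans (sym (⊕-assoc x y z)) (trans (cong (_⊕ z) (⊕-comm x y)) (⊕-assoc y x z))

flipBy : ℕ → Stat → Stat
flipBy zero    x = x
flipBy (suc t) x = swap (flipBy t x)

flipBy-swap : ∀ t x → flipBy t (swap x) ≡ swap (flipBy t x)
flipBy-swap zero    x = refl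
flipBy-swap (suc t) x = cong swap (flipBy-swap t x)

flipBy-⊕ : ∀ t x y → flipBy t (x ⊕ y) ≡ flipBy t x ⊕ flipBy t y
flipBy-⊕ zero    x y = refl
flipBy-⊕ (suc t) x y = cong swap (flipBy-⊕ t x y)

flipBy-isOdd : ∀ t x → flipBy t x ≡ (if isOdd t then swap x else x)
flipBy-isOdd zero          x = refl
flipBy-isOdd (suc zero)    x = refl
flipBy-isOdd (suc (suc t)) x = flipBy-isOdd t x

flipBy-double : ∀ k x → flipBy (k + k) x ≡ x
flipBy-double zero    x = refl
flipBy-double (suc k) x = trans (cong (λ t → flipBy (suc t) x) (+-suc k k)) (flipBy-double k x)

unitAt : ℕ → Stat
unitAt s = flipBy s (0 , 1)

letterAt : ℕ → Bool → Stat
letterAt s true  = unitAt s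
letterAt s false = 0 , 0

-- The true letters of a word, counted by parity of position, when its first letter sits at position s.
count : ℕ → List Bool → Stat
count s []      = 0 , 0
count s (b ∷ w) = letterAt s b ⊕ count (suc s) w

count-suc : ∀ s w → count (suc s) w ≡ swap (count s w)
count-suc s []          = refl
count-suc s (true ∷ w)  = cong (swap (unitAt s) ⊕_) (count-suc (suc s) w)
count-suc s (false ∷ w) = cong ((0 , 0) ⊕_) (count-suc (suc s) w)

count-+ : ∀ t s w → count (t + s) w ≡ flipBy t (count s w)
count-+ zero    s w = refl
count-+ (suc t) s w = trans (count-suc (t + s) w) (cong swap (count-+ t s w))

count-++ : ∀ s u v → count s (u ++ v) ≡ count s u ⊕ count (length u + s) v
count-++ s []      v = refl
count-++ s (b ∷ u) v = begin
  letterAt s b ⊕ count (suc s) (u ++ v)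
    ≡⟨ cong (letterAt s b ⊕_) (count-++ (suc s) u v) ⟩
  letterAt s b ⊕ (count (suc s) u ⊕ count (length u + suc s) v)
    ≡⟨ cong (λ t → letterAt s b ⊕ (count (suc s) u ⊕ count t v)) (+-suc (length u) s) ⟩
  letterAt s b ⊕ (count (suc s) u ⊕ count (suc (length u) + s) v)
    ≡⟨ ⊕-assoc (letterAt s b) _ _ ⟨
  (letterAt s b ⊕ count (suc s) u) ⊕ count (suc (length u) + s) v ∎
  where open ≡-Reasoning

count-complement : ∀ s w → count s w ⊕ count s (map not w) ≡ count s (replicate (length w) true)
count-complement s []          = refl
count-complement s (true ∷ w)  = trans (⊕-assoc (unitAt s) _ _) (cong (unitAt s ⊕_) (count-complement (suc s) w))
count-complement s (false ∷ w) = trans (⊕-middle (count (suc s) w) (unitAt s) _) (cong (unitAt s ⊕_) (count-complement (suc s) w))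

-- Reversing a word of length L sends position s + i to s + (L - 1 - i).
count-reverse : ∀ s w → count s (reverse w) ≡ flipBy (suc (length w)) (count s w)
count-reverse s []      = refl
count-reverse s (b ∷ w) = begin
  count s (reverse (b ∷ w))
    ≡⟨ cong (count s) (unfold-reverse b w) ⟩
  count s (reverse w ++ [ b ])
    ≡⟨ count-++ s (reverse w) [ b ] ⟩
  count s (reverse w) ⊕ count (length (reverse w) + s) [ b ]
    ≡⟨ cong₂ (λ c t → c ⊕ count (t + s) [ b ]) (count-reverse s w) (length-reverse w) ⟩
  flipBy (suc L) (count s w) ⊕ count (L + s) [ b ]
    ≡⟨ cong (flipBy (suc L) (count s w) ⊕_) (count-+ L s [ b ]) ⟩
  flipBy (suc L) (count s w) ⊕ flipBy L (count s [ b ])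
    ≡⟨ cong (λ c → flipBy (suc L) (count s w) ⊕ flipBy L c) (⊕-identityʳ (letterAt s b)) ⟩
  flipBy (suc L) (count s w) ⊕ flipBy L (letterAt s b)
    ≡⟨ ⊕-comm (flipBy (suc L) (count s w)) (flipBy L (letterAt s b)) ⟩
  flipBy L (letterAt s b) ⊕ flipBy (suc L) (count s w)
    ≡⟨ cong (flipBy L (letterAt s b) ⊕_) (sym (flipBy-swap L (count s w))) ⟩
  flipBy L (letterAt s b) ⊕ flipBy L (swap (count s w))
    ≡⟨ cong (λ c → flipBy L (letterAt s b) ⊕ flipBy L c) (count-suc s w) ⟨
  flipBy L (letterAt s b) ⊕ flipBy L (count (suc s) w)
    ≡⟨ flipBy-⊕ L _ _ ⟨
  flipBy L (count s (b ∷ w)) ∎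
  where
  open ≡-Reasoning
  L : ℕ
  L = length w

unitAt-isOdd : ∀ s → unitAt s ≡ (if isOdd s then (1 , 0) else (0 , 1))
unitAt-isOdd s = flipBy-isOdd s (0 , 1)

unitAt-⊕-unitAt-suc : ∀ s → unitAt s ⊕ unitAt (suc s) ≡ (1 , 1)
unitAt-⊕-unitAt-suc zero    = refl
unitAt-⊕-unitAt-suc (suc s) = cong swap (unitAt-⊕-unitAt-suc s)

count-replicate-double : ∀ s k → count s (replicate (k + k) true) ≡ (k , k)
count-replicate-double s zero    = refl
count-replicate-double s (suc k) = begin
  count s (replicate (suc k + suc k) true)
    ≡⟨ cong (λ t → count s (replicate (suc t) true)) (+-suc k k) ⟩
  unitAt s ⊕ unitAt (suc s) ⊕ count (2 + s) (replicate (k + k) true)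
    ≡⟨ ⊕-assoc (unitAt s) _ _ ⟨
  (unitAt s ⊕ unitAt (suc s)) ⊕ count (2 + s) (replicate (k + k) true)
    ≡⟨ cong₂ _⊕_ (unitAt-⊕-unitAt-suc s) (count-+ 2 s (replicate (k + k) true)) ⟩
  (1 , 1) ⊕ count s (replicate (k + k) true)
    ≡⟨ cong ((1 , 1) ⊕_) (count-replicate-double s k) ⟩
  (suc k , suc k) ∎
  where open ≡-Reasoning

<ᵇ-true : ∀ {m n} → m < n → (m <ᵇ n) ≡ true
<ᵇ-true {zero}  {suc n} _         = refl
<ᵇ-true {suc m} {suc n} (s≤s m<n) = <ᵇ-true m<n

<ᵇ-false : ∀ {m n} → n ≤ m → (m <ᵇ n) ≡ false
<ᵇ-false {m}     {zero}  _         = refl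
<ᵇ-false {suc m} {suc n} (s≤s n≤m) = <ᵇ-false n≤m

<ᵇ-not : ∀ {m n} → m ≢ n → (m <ᵇ n) ≡ not (n <ᵇ m)
<ᵇ-not {m} {n} m≢n with <-cmp m n
... | tri< m<n _ _ = trans (<ᵇ-true m<n) (cong not (sym (<ᵇ-false (<⇒≤ m<n))))
... | tri≈ _ m≡n _ = ⊥-elim (m≢n m≡n)
... | tri> _ _ n<m = trans (<ᵇ-false (<⇒≤ n<m)) (cong not (sym (<ᵇ-true n<m)))

∸-<ᵇ : ∀ {m x y} → x ≤ m → y ≤ m → (m ∸ y <ᵇ m ∸ x) ≡ (x <ᵇ y)
∸-<ᵇ {m} {x} {y} x≤m y≤m with <-cmp x y
... | tri< x<y _ _ = trans (<ᵇ-true (∸-monoʳ-< x<y y≤m)) (sym (<ᵇ-true x<y))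
... | tri≈ _ refl _ = trans (<ᵇ-false {m ∸ x} ≤-refl) (sym (<ᵇ-false {x} ≤-refl))
... | tri> _ _ y<x = trans (<ᵇ-false (∸-monoʳ-≤ m (<⇒≤ y<x))) (sym (<ᵇ-false (<⇒≤ y<x)))

-- The i-th letter is true iff π has a descent at position i + 1.
descents : List ℕ → List Bool
descents []          = []
descents (x ∷ [])    = []
descents (x ∷ y ∷ w) = (y <ᵇ x) ∷ descents (y ∷ w)

length-descents : ∀ π → length (descents π) ≡ pred (length π)
length-descents []          = refl
length-descents (x ∷ [])    = refl
length-descents (x ∷ y ∷ w) = cong suc (length-descents (y ∷ w))

stat : List ℕ → Stat
stat π = odes π , edes π

oddEven : List ℕ → Stat
oddEven ds = countOdd ds , countEven ds

oddEven-∷ : ∀ k ds → oddEven (k ∷ ds) ≡ unitAt k ⊕ oddEven ds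
oddEven-∷ k ds rewrite unitAt-isOdd k with isOdd k
... | true  = refl
... | false = refl

oddEven-if : ∀ b k ds → oddEven (if b then k ∷ ds else ds) ≡ letterAt k b ⊕ oddEven ds
oddEven-if true  k ds = oddEven-∷ k ds
oddEven-if false k ds = refl

oddEven-descentsFrom : ∀ k π → oddEven (descentsFrom k π) ≡ count k (descents π)
oddEven-descentsFrom k []          = refl
oddEven-descentsFrom k (x ∷ [])    = refl
oddEven-descentsFrom k (x ∷ y ∷ w) =
  trans (oddEven-if (y <ᵇ x) k _) (cong (letterAt k (y <ᵇ x) ⊕_) (oddEven-descentsFrom (suc k) (y ∷ w)))

stat≡count-descents : ∀ π → stat π ≡ count 1 (descents π)
stat≡count-descents = oddEven-descentsFrom 1

descents-map-∸ : ∀ {m π} → All (_≤ m) π → Unique π → descents (map (m ∸_) π) ≡ map not (descents π)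
descents-map-∸ []                 []                  = refl
descents-map-∸ (_ ∷ [])           (_ ∷ [])            = refl
descents-map-∸ (x≤m ∷ y≤m ∷ bnds) ((x≢y ∷ _) ∷ uniq) =
  cong₂ _∷_ (trans (∸-<ᵇ x≤m y≤m) (<ᵇ-not x≢y)) (descents-map-∸ (y≤m ∷ bnds) uniq)

descents-∷ʳ-∷ʳ : ∀ w y x → descents (w ∷ʳ y ∷ʳ x) ≡ descents (w ∷ʳ y) ∷ʳ (x <ᵇ y)
descents-∷ʳ-∷ʳ []          y x = refl
descents-∷ʳ-∷ʳ (a ∷ [])    y x = refl
descents-∷ʳ-∷ʳ (a ∷ b ∷ w) y x = cong ((b <ᵇ a) ∷_) (descents-∷ʳ-∷ʳ (b ∷ w) y x)

descents-reverse : ∀ π → Unique π → descents (reverse π) ≡ reverse (map not (descents π))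
descents-reverse []          _ = refl
descents-reverse (x ∷ [])    _ = refl
descents-reverse (x ∷ y ∷ w) ((x≢y ∷ _) ∷ uniq) = begin
  descents (reverse (x ∷ y ∷ w))
    ≡⟨ cong descents (trans (unfold-reverse x (y ∷ w)) (cong (_∷ʳ x) (unfold-reverse y w))) ⟩
  descents (reverse w ∷ʳ y ∷ʳ x)
    ≡⟨ descents-∷ʳ-∷ʳ (reverse w) y x ⟩
  descents (reverse w ∷ʳ y) ∷ʳ (x <ᵇ y)
    ≡⟨ cong₂ (λ u b → descents u ∷ʳ b) (sym (unfold-reverse y w)) (<ᵇ-not x≢y) ⟩
  descents (reverse (y ∷ w)) ∷ʳ not (y <ᵇ x)
    ≡⟨ cong (_∷ʳ not (y <ᵇ x)) (descents-reverse (y ∷ w) uniq) ⟩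
  reverse (map not (descents (y ∷ w))) ∷ʳ not (y <ᵇ x)
    ≡⟨ unfold-reverse (not (y <ᵇ x)) (map not (descents (y ∷ w))) ⟨
  reverse (map not (descents (x ∷ y ∷ w))) ∎
  where open ≡-Reasoning

InRange : ℕ → ℕ → Set
InRange n x = 1 ≤ x × x ≤ n

record IsPermutation (n : ℕ) (w : List ℕ) : Set where
  constructor isPermutation
  field
    length≡ : length w ≡ n
    inRange : All (InRange n) w
    unique  : Unique w

words≡cartesianProductWith : ∀ xs k → words xs (suc k) ≡ cartesianProductWith (λ w x → x ∷ w) (words xs k) xs
words≡cartesianProductWith xs k = sym (cartesianProductWith-concatMap (λ w x → x ∷ w) (words xs k) xs)

∈-words⁻ : ∀ xs k {w} → w ∈ words xs k → length w ≡ k × All (_∈ xs) w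
∈-words⁻ xs zero    (here refl) = refl , []
∈-words⁻ xs (suc k) w∈
  with v , x , v∈ , x∈ , refl ← ∈-cartesianProductWith⁻ (λ w x → x ∷ w) (words xs k) xs
                                   (subst (_ ∈_) (words≡cartesianProductWith xs k) w∈)
  = cong suc (proj₁ (∈-words⁻ xs k v∈)) , x∈ ∷ proj₂ (∈-words⁻ xs k v∈)

∈-words⁺ : ∀ xs k {w} → length w ≡ k → All (_∈ xs) w → w ∈ words xs k
∈-words⁺ xs zero    {[]}    _   _          = here refl
∈-words⁺ xs (suc k) {x ∷ w} len (x∈ ∷ w∈) =
  subst (_ ∈_) (sym (words≡cartesianProductWith xs k))
        (∈-cartesianProductWith⁺ (λ w x → x ∷ w) (∈-words⁺ xs k (suc-injective len) w∈) x∈)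

words-unique : ∀ xs k → Unique xs → Unique (words xs k)
words-unique xs zero    _     = [] ∷ []
words-unique xs (suc k) xs-un =
  subst Unique (sym (words≡cartesianProductWith xs k))
        (Unique.cartesianProductWith⁺ (λ w x → x ∷ w) (λ { refl → refl , refl }) (words-unique xs k xs-un) xs-un)

∈-range : ∀ {n x} → x ∈ range n ⇔ InRange n x
∈-range {n} = mk⇔ to from
  where
  to : ∀ {x} → x ∈ range n → InRange n x
  to x∈ with i , i<n , refl ← ∈-applyUpTo⁻ suc x∈ = s≤s z≤n , i<n
  from : ∀ {x} → InRange n x → x ∈ range n
  from {suc i} (_ , i<n) = ∈-applyUpTo⁺ suc i<n

∈-Sym⁻ : ∀ {n w} → w ∈ Sym n → IsPermutation n w
∈-Sym⁻ {n} w∈ with w∈words , uniq ← ∈-filter⁻ (UDec.unique? _≟_) w∈ =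
  let len , all∈ = ∈-words⁻ (range n) n w∈words in
  isPermutation len (All.map (Equivalence.to ∈-range) all∈) uniq

∈-Sym⁺ : ∀ {n w} → IsPermutation n w → w ∈ Sym n
∈-Sym⁺ {n} (isPermutation len bnds uniq) =
  ∈-filter⁺ (UDec.unique? _≟_) (∈-words⁺ (range n) n len (All.map (Equivalence.from ∈-range) bnds)) uniq

Sym-unique : ∀ n → Unique (Sym n)
Sym-unique n = Unique.filter⁺ (UDec.unique? _≟_)
  (words-unique (range n) n (Unique.applyUpTo⁺₁ suc n (λ i<j _ e → <-irrefl (suc-injective e) i<j)))

Sym-IsPermutation : ∀ n → All (IsPermutation n) (Sym n)
Sym-IsPermutation n = All.tabulate ∈-Sym⁻

Unique-resp-↭ : {A : Set} {xs ys : List A} → xs ↭ ys → Unique xs → Unique ys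
Unique-resp-↭ p = SetoidPermutation.Unique-resp-↭ (↭⇒↭ₛ p)

↭-from-Unique : {A : Set} {xs ys : List A} → Unique xs → Unique ys → (∀ {x} → x ∈ xs ⇔ x ∈ ys) → xs ↭ ys
↭-from-Unique xs-un ys-un same = ∼bag⇒↭ (unique∧set⇒bag xs-un ys-un same)

map-Sym-involution : ∀ n (f : List ℕ → List ℕ) → (∀ {π} → IsPermutation n π → IsPermutation n (f π)) →
                     (∀ {π} → IsPermutation n π → f (f π) ≡ π) → map f (Sym n) ↭ Sym n
map-Sym-involution n f f-perm f-inv = ↭-from-Unique map-unique (Sym-unique n) (mk⇔ to from)
  where
  ff≡id : map f (map f (Sym n)) ≡ Sym n
  ff≡id = trans (sym (map-∘ (Sym n))) (trans (map-cong-All (All.map f-inv (Sym-IsPermutation n))) (map-id (Sym n)))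
  map-unique : Unique (map f (Sym n))
  map-unique = Unique.map⁻ (subst Unique (sym ff≡id) (Sym-unique n))
  to : ∀ {σ} → σ ∈ map f (Sym n) → σ ∈ Sym n
  to σ∈ with π , π∈ , refl ← ∈-map⁻ f σ∈ = ∈-Sym⁺ (f-perm (∈-Sym⁻ π∈))
  from : ∀ {σ} → σ ∈ Sym n → σ ∈ map f (Sym n)
  from σ∈ = subst (_∈ map f (Sym n)) (f-inv (∈-Sym⁻ σ∈)) (∈-map⁺ f (∈-Sym⁺ (f-perm (∈-Sym⁻ σ∈))))

InRange-pred : ∀ {m x} → InRange (suc m) x → suc m ≢ x → InRange m x
InRange-pred (1≤x , x≤1+m) 1+m≢x = 1≤x , ≤-pred (≤∧≢⇒< x≤1+m (1+m≢x ∘ sym))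

All-InRange-pred : ∀ {m w} → All (InRange (suc m)) w → All (suc m ≢_) w → All (InRange m) w
All-InRange-pred bnds ≢max = All.zipWith (λ (b , ne) → InRange-pred b ne) (bnds , ≢max)

remove-max : ∀ {m} ys zs → Unique (ys ++ suc m ∷ zs) → All (InRange (suc m)) (ys ++ suc m ∷ zs) →
             Unique (ys ++ zs) × All (InRange m) (ys ++ zs)
remove-max {m} ys zs uniq bnds
  with max∉ ∷ uniq′ ← Unique-resp-↭ (shift (suc m) ys zs) uniq
     | _ ∷ bnds′   ← All-resp-↭ (shift (suc m) ys zs) bnds
  = uniq′ , All-InRange-pred bnds′ max∉

length-++-∷ : ∀ {A : Set} (ys zs : List A) x → length (ys ++ x ∷ zs) ≡ suc (length (ys ++ zs))
length-++-∷ ys zs x = ↭-length (shift x ys zs)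

pigeonhole : ∀ m {w} → Unique w → All (InRange m) w → length w ≤ m
pigeonhole zero    {[]}    _    _                   = z≤n
pigeonhole zero    {x ∷ w} _    ((1≤x , x≤0) ∷ _)   = ⊥-elim (1+n≰n (≤-trans 1≤x x≤0))
pigeonhole (suc m) {w}     uniq bnds with suc m ∈? w
... | no  max∉w = m≤n⇒m≤1+n (pigeonhole m uniq (All-InRange-pred bnds (AllP.¬Any⇒All¬ w max∉w)))
... | yes max∈w with ys , zs , refl ← ∈-∃++ max∈w =
  let uniq′ , bnds′ = remove-max ys zs uniq bnds in
  subst (_≤ suc m) (sym (length-++-∷ ys zs (suc m))) (s≤s (pigeonhole m uniq′ bnds′))

max-∈ : ∀ {n σ} → IsPermutation (suc n) σ → suc n ∈ σ
max-∈ {n} {σ} (isPermutation len bnds uniq) with suc n ∈? σ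
... | yes max∈σ = max∈σ
... | no  max∉σ = ⊥-elim (1+n≰n (subst (_≤ n) len
        (pigeonhole n uniq (All-InRange-pred bnds (AllP.¬Any⇒All¬ σ max∉σ)))))

insert : ℕ → ℕ → List ℕ → List ℕ
insert i x w = take i w ++ x ∷ drop i w

insert-↭ : ∀ i x w → insert i x w ↭ x ∷ w
insert-↭ i x w = ↭-trans (shift x (take i w) (drop i w)) (↭-reflexive (cong (x ∷_) (take++drop≡id i w)))

insert-length-++ : ∀ x ys zs → insert (length ys) x (ys ++ zs) ≡ ys ++ x ∷ zs
insert-length-++ x []       zs = refl
insert-length-++ x (y ∷ ys) zs = cong (y ∷_) (insert-length-++ x ys zs)

delete : ℕ → List ℕ → List ℕ
delete x []      = []
delete x (y ∷ w) with y ≟ x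
... | yes _ = w
... | no  _ = y ∷ delete x w

indexOf : ℕ → List ℕ → ℕ
indexOf x []      = 0
indexOf x (y ∷ w) with y ≟ x
... | yes _ = 0
... | no  _ = suc (indexOf x w)

delete-insert : ∀ {x} i w → All (x ≢_) w → delete x (insert i x w) ≡ w
delete-insert {x} zero    w       _ with x ≟ x
... | yes _   = refl
... | no  x≢x = ⊥-elim (x≢x refl)
delete-insert {x} (suc i) []      _ with x ≟ x
... | yes _   = refl
... | no  x≢x = ⊥-elim (x≢x refl)
delete-insert {x} (suc i) (y ∷ w) (x≢y ∷ x∉w) with y ≟ x
... | yes y≡x = ⊥-elim (x≢y (sym y≡x))
... | no  _   = cong (y ∷_) (delete-insert i w x∉w)

indexOf-insert : ∀ {x} i w → All (x ≢_) w → i ≤ length w → indexOf x (insert i x w) ≡ i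
indexOf-insert {x} zero    w       _ _ with x ≟ x
... | yes _   = refl
... | no  x≢x = ⊥-elim (x≢x refl)
indexOf-insert {x} (suc i) (y ∷ w) (x≢y ∷ x∉w) (s≤s i≤) with y ≟ x
... | yes y≡x = ⊥-elim (x≢y (sym y≡x))
... | no  _   = cong suc (indexOf-insert i w x∉w i≤)

max∉ : ∀ {n π} → IsPermutation n π → All (suc n ≢_) π
max∉ p = All.map (λ (_ , x≤n) 1+n≡x → 1+n≰n (subst (_≤ _) (sym 1+n≡x) x≤n)) (IsPermutation.inRange p)

insert-IsPermutation : ∀ {n π} i → IsPermutation n π → IsPermutation (suc n) (insert i (suc n) π)
insert-IsPermutation {n} {π} i p@(isPermutation len bnds uniq) = isPermutation
  (trans (↭-length (insert-↭ i (suc n) π)) (cong suc len))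
  (All-resp-↭ (↭-sym (insert-↭ i (suc n) π)) ((s≤s z≤n , ≤-refl) ∷ All.map (λ (1≤x , x≤n) → 1≤x , m≤n⇒m≤1+n x≤n) bnds))
  (Unique-resp-↭ (↭-sym (insert-↭ i (suc n) π)) (max∉ p ∷ uniq))

insertions : ℕ → List (List ℕ)
insertions n = cartesianProductWith (λ π i → insert i (suc n) π) (Sym n) (upTo (suc n))

∈-insertions⁻ : ∀ {n σ} → σ ∈ insertions n → IsPermutation (suc n) σ
∈-insertions⁻ {n} σ∈ with π , i , π∈ , _ , refl ← ∈-cartesianProductWith⁻ (λ π i → insert i (suc n) π) (Sym n) (upTo (suc n)) σ∈ =
  insert-IsPermutation i (∈-Sym⁻ π∈)

∈-insertions⁺ : ∀ {n σ} → IsPermutation (suc n) σ → σ ∈ insertions n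
∈-insertions⁺ {n} p@(isPermutation len bnds uniq) with ys , zs , refl ← ∈-∃++ (max-∈ p) =
  subst (_∈ insertions n) (insert-length-++ (suc n) ys zs)
    (∈-cartesianProductWith⁺ (λ π i → insert i (suc n) π) (∈-Sym⁺ π-perm) (∈-upTo⁺ ys<))
  where
  uniq′ : Unique (ys ++ zs)
  uniq′ = proj₁ (remove-max ys zs uniq bnds)
  bnds′ : All (InRange n) (ys ++ zs)
  bnds′ = proj₂ (remove-max ys zs uniq bnds)
  π-perm : IsPermutation n (ys ++ zs)
  π-perm = isPermutation (suc-injective (trans (sym (length-++-∷ ys zs (suc n))) len)) bnds′ uniq′
  ys< : length ys < suc n
  ys< = subst (length ys <_) (trans (sym (length-++ ys)) len) (m<m+n (length ys) (s≤s z≤n))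

-- Deleting n + 1 and recording its position recovers (π , i), and Sym n × [0, n] is duplicate-free.
insertions-unique : ∀ n → Unique (insertions n)
insertions-unique n = Unique.map⁻ (subst Unique (sym positions) (Unique.cartesianProduct⁺ (Sym-unique n) (Unique.upTo⁺ (suc n))))
  where
  removal : List ℕ → List ℕ × ℕ
  removal σ = delete (suc n) σ , indexOf (suc n) σ
  positions : map removal (insertions n) ≡ cartesianProductWith _,_ (Sym n) (upTo (suc n))
  positions = trans (map-cartesianProductWith removal (λ π i → insert i (suc n) π) (Sym n) (upTo (suc n)))
    (cartesianProductWith-cong-All (All.map (λ {π} p → All.map (λ {i} i<1+n → cong₂ _,_ (delete-insert i π (max∉ p))
        (indexOf-insert i π (max∉ p) (subst (_ ≤_) (sym (IsPermutation.length≡ p)) (≤-pred i<1+n)))) (upTo-< (suc n)))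
      (Sym-IsPermutation n)))

Sym-suc↭insertions : ∀ n → Sym (suc n) ↭ insertions n
Sym-suc↭insertions n = ↭-from-Unique (Sym-unique (suc n)) (insertions-unique n)
  (mk⇔ (λ σ∈ → ∈-insertions⁺ (∈-Sym⁻ {suc n} σ∈)) (λ σ∈ → ∈-Sym⁺ (∈-insertions⁻ {n} σ∈)))

-- Padded descent words and the position of the maximum

-- The descent word of 0 π 0: one letter longer than the length of π, starting with false and ending with true.
paddedDescents : List ℕ → List Bool
paddedDescents π = descents (0 ∷ π ++ [ 0 ])

-- The effect on paddedDescents of inserting a new maximum after i letters.
insertPeak : ℕ → List Bool → List Bool
insertPeak i e = take i e ++ false ∷ true ∷ drop (suc i) e

descents-insert-max : ∀ i {a M} w → a < M → All (_< M) w → i ≤ length w →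
                      descents (a ∷ insert i M w ++ [ 0 ]) ≡ insertPeak i (descents (a ∷ w ++ [ 0 ]))
descents-insert-max zero    []      a<M _          _ = cong₂ (λ u v → u ∷ v ∷ []) (<ᵇ-false (<⇒≤ a<M)) (<ᵇ-true (≤-trans (s≤s z≤n) a<M))
descents-insert-max zero    (b ∷ w) a<M (b<M ∷ _)  _ = cong₂ (λ u v → u ∷ v ∷ descents (b ∷ w ++ [ 0 ])) (<ᵇ-false (<⇒≤ a<M)) (<ᵇ-true b<M)
descents-insert-max (suc i) (b ∷ w) a<M (b<M ∷ w<M) (s≤s i≤) = cong (_ ∷_) (descents-insert-max i w b<M w<M i≤)

DescentWords : ℕ → List (List Bool)
DescentWords zero    = [ [ false ] ]
DescentWords (suc n) = cartesianProductWith (λ e i → insertPeak i e) (DescentWords n) (upTo (suc n))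

map-paddedDescents-Sym : ∀ n → map paddedDescents (Sym n) ↭ DescentWords n
map-paddedDescents-Sym zero    = ↭-refl
map-paddedDescents-Sym (suc n) = begin
  map paddedDescents (Sym (suc n))
    ↭⟨ map⁺ paddedDescents (Sym-suc↭insertions n) ⟩
  map paddedDescents (insertions n)
    ≡⟨ map-cartesianProductWith paddedDescents _ (Sym n) (upTo (suc n)) ⟩
  cartesianProductWith (λ π i → paddedDescents (insert i (suc n) π)) (Sym n) (upTo (suc n))
    ≡⟨ cartesianProductWith-cong-All (All.map insert-max (Sym-IsPermutation n)) ⟩
  cartesianProductWith (λ π i → insertPeak i (paddedDescents π)) (Sym n) (upTo (suc n))
    ≡⟨ cartesianProductWith-mapˡ (λ e i → insertPeak i e) paddedDescents (Sym n) (upTo (suc n)) ⟨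
  cartesianProductWith (λ e i → insertPeak i e) (map paddedDescents (Sym n)) (upTo (suc n))
    ↭⟨ cartesianProductWith⁺ˡ (λ e i → insertPeak i e) (upTo (suc n)) (map-paddedDescents-Sym n) ⟩
  DescentWords (suc n) ∎
  where
  open PermutationReasoning
  insert-max : ∀ {π} → IsPermutation n π → All (λ i → paddedDescents (insert i (suc n) π) ≡ insertPeak i (paddedDescents π)) (upTo (suc n))
  insert-max {π} (isPermutation len bnds _) = All.map (λ {i} i<1+n →
    descents-insert-max i π (s≤s z≤n) (All.map (λ (_ , x≤n) → s≤s x≤n) bnds) (subst (i ≤_) (sym len) (≤-pred i<1+n))) (upTo-< (suc n))

Padded : ℕ → List Bool → Set
Padded n e = Σ (List Bool) λ t → e ≡ false ∷ t × length t ≡ n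

length-insertPeak : ∀ i e → i < length e → length (insertPeak i e) ≡ suc (length e)
length-insertPeak zero    (c ∷ e) _         = refl
length-insertPeak (suc i) (c ∷ e) (s≤s i<) = cong suc (length-insertPeak i e i<)

insertPeak-Padded : ∀ {n e i} → Padded n e → i < suc n → Padded (suc n) (insertPeak i e)
insertPeak-Padded {i = zero}  (t , refl , len) _          = true ∷ t , refl , cong suc len
insertPeak-Padded {i = suc i} (t , refl , len) (s≤s i<n) =
  insertPeak i t , refl , trans (length-insertPeak i t (subst (i <_) (sym len) i<n)) (cong suc len)

DescentWords-Padded : ∀ n → All (Padded n) (DescentWords n)
DescentWords-Padded zero    = ([] , refl , refl) ∷ []
DescentWords-Padded (suc n) = All.tabulate λ e∈ →
  let e′ , i , e′∈ , i∈ , e≡ = ∈-cartesianProductWith⁻ (λ e i → insertPeak i e) (DescentWords n) (upTo (suc n)) e∈ in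
  subst (Padded (suc n)) (sym e≡) (insertPeak-Padded (All.lookup (DescentWords-Padded n) e′∈) (∈-upTo⁻ i∈))

dropLast : List Bool → List Bool
dropLast []          = []
dropLast (x ∷ [])    = []
dropLast (x ∷ y ∷ w) = x ∷ dropLast (y ∷ w)

-- The statistic read off a padded word: its final letter is the descent into the padding and is ignored.
padStat : List Bool → Stat
padStat e = count 0 (dropLast e)

dropLast-∷-descents : ∀ x a w → dropLast (x ∷ descents (a ∷ w ++ [ 0 ])) ≡ x ∷ descents (a ∷ w)
dropLast-∷-descents x a []      = refl
dropLast-∷-descents x a (b ∷ w) = cong (x ∷_) (dropLast-∷-descents (b <ᵇ a) b w)

padStat-paddedDescents : ∀ π → padStat (paddedDescents π) ≡ stat π
padStat-paddedDescents []      = refl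
padStat-paddedDescents (a ∷ w) =
  trans (cong (count 0) (dropLast-∷-descents false a w)) (sym (stat≡count-descents (a ∷ w)))

Stats : ℕ → List Stat
Stats n = map stat (Sym n)

Stats↭map-padStat : ∀ n → Stats n ↭ map padStat (DescentWords n)
Stats↭map-padStat n = begin
  map stat (Sym n)                          ≡⟨ map-cong (λ π → sym (padStat-paddedDescents π)) (Sym n) ⟩
  map (padStat ∘ paddedDescents) (Sym n)    ≡⟨ map-∘ (Sym n) ⟩
  map padStat (map paddedDescents (Sym n))  ↭⟨ map⁺ padStat (map-paddedDescents-Sym n) ⟩
  map padStat (DescentWords n)              ∎
  where open PermutationReasoning

-- For the cut after j letters of π, the padded descent words of the standardisations of the two pieces.
prefix : ℕ → List Bool → List Bool
prefix zero    e = [ false ]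
prefix (suc j) e = take (suc j) e ++ [ true ]

suffix : ℕ → List Bool → List Bool
suffix j e = false ∷ drop (suc j) e

split : ℕ → List Bool → List Bool × List Bool
split j e = prefix j e , suffix j e

split-zero : ∀ {n e} → Padded n e → split 0 e ≡ ([ false ] , e)
split-zero (t , refl , _) = refl

prefix-insertPeak-left : ∀ i j e → i ≤ j → suc j ≤ length e → prefix (suc j) (insertPeak i e) ≡ insertPeak i (prefix j e)
prefix-insertPeak-left zero    zero    (c ∷ e) z≤n      _        = refl
prefix-insertPeak-left zero    (suc j) (c ∷ e) z≤n      _        = refl
prefix-insertPeak-left (suc i) (suc j) (c ∷ e) (s≤s i≤) (s≤s j<) =
  cong (c ∷_) (trans (prefix-insertPeak-left i j e i≤ j<) (insertPeak-prefix i j i≤))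
  where
  insertPeak-prefix : ∀ i j → i ≤ j → insertPeak i (prefix j e) ≡ insertPeak i (take j e ++ [ true ])
  insertPeak-prefix zero    zero    z≤n = refl
  insertPeak-prefix zero    (suc j) z≤n = refl
  insertPeak-prefix (suc i) (suc j) _   = refl

suffix-insertPeak-left : ∀ i j e → i ≤ j → suc j ≤ length e → suffix (suc j) (insertPeak i e) ≡ suffix j e
suffix-insertPeak-left zero    j       (c ∷ e) z≤n      _        = refl
suffix-insertPeak-left (suc i) (suc j) (c ∷ e) (s≤s i≤) (s≤s j<) = suffix-insertPeak-left i j e i≤ j<

prefix-insertPeak-right : ∀ j k e → j + k < length e → prefix j (insertPeak (j + k) e) ≡ prefix j e
prefix-insertPeak-right zero    k e _  = refl
prefix-insertPeak-right (suc j) k e lt = cong (_++ [ true ]) (take-insertPeak (suc j) e lt)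
  where
  take-insertPeak : ∀ j e → j + k < length e → take j (insertPeak (j + k) e) ≡ take j e
  take-insertPeak zero    e       _         = refl
  take-insertPeak (suc j) (c ∷ e) (s≤s lt) = cong (c ∷_) (take-insertPeak j e lt)

suffix-insertPeak-right : ∀ j k e → j + k < length e → suffix j (insertPeak (j + k) e) ≡ insertPeak k (suffix j e)
suffix-insertPeak-right j k e lt = trans (cong (false ∷_) (drop-insertPeak j e lt)) (head-insertPeak k)
  where
  tail-insertPeak : ∀ k c c′ e → drop 1 (insertPeak k (c ∷ e)) ≡ drop 1 (insertPeak k (c′ ∷ e))
  tail-insertPeak zero    c c′ e = refl
  tail-insertPeak (suc k) c c′ e = refl
  drop-insertPeak : ∀ j e → j + k < length e → drop (suc j) (insertPeak (j + k) e) ≡ drop 1 (insertPeak k (false ∷ drop (suc j) e))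
  drop-insertPeak zero    (c ∷ e) _         = tail-insertPeak k c false e
  drop-insertPeak (suc j) (c ∷ e) (s≤s lt) = drop-insertPeak j e lt
  head-insertPeak : ∀ k → false ∷ drop 1 (insertPeak k (suffix j e)) ≡ insertPeak k (suffix j e)
  head-insertPeak zero    = refl
  head-insertPeak (suc k) = refl

growLeft : ℕ → List Bool × List Bool → List (List Bool × List Bool)
growLeft j (a , b) = map (λ i → insertPeak i a , b) (upTo (suc j))

growRight : ℕ → List Bool × List Bool → List (List Bool × List Bool)
growRight l (a , b) = map (λ k → a , insertPeak k b) (upTo l)

-- A new peak lands either left of the cut after j + 1 letters (a peak of the prefix) or right of it.
split-insertPeak : ∀ j l e → length e ≡ suc (j + l) →
  map (λ i → split (suc j) (insertPeak i e)) (upTo (suc j + l)) ≡ growLeft j (split j e) ++ growRight l (split (suc j) e)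
split-insertPeak j l e len = begin
  map F (upTo (suc j + l))
    ≡⟨ cong (map F) (applyUpTo-+ id (suc j) l) ⟩
  map F (upTo (suc j) ++ applyUpTo (suc j +_) l)
    ≡⟨ map-++ F (upTo (suc j)) _ ⟩
  map F (upTo (suc j)) ++ map F (applyUpTo (suc j +_) l)
    ≡⟨ cong (map F (upTo (suc j)) ++_) (trans (map-applyUpTo (suc j +_) F l) (sym (map-upTo (F ∘ (suc j +_)) l))) ⟩
  map F (upTo (suc j)) ++ map (F ∘ (suc j +_)) (upTo l)
    ≡⟨ cong₂ _++_ (map-cong-All (All.map left (upTo-< (suc j)))) (map-cong-All (All.map right (upTo-< l))) ⟩
  growLeft j (split j e) ++ growRight l (split (suc j) e) ∎
  where
  open ≡-Reasoning
  F : ℕ → List Bool × List Bool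
  F i = split (suc j) (insertPeak i e)
  j<e : suc j ≤ length e
  j<e = subst (suc j ≤_) (sym len) (s≤s (m≤m+n j l))
  left : ∀ {i} → i < suc j → F i ≡ (insertPeak i (prefix j e) , suffix j e)
  left {i} i<1+j = cong₂ _,_ (prefix-insertPeak-left i j e (≤-pred i<1+j) j<e) (suffix-insertPeak-left i j e (≤-pred i<1+j) j<e)
  right : ∀ {k} → k < l → F (suc j + k) ≡ (prefix (suc j) e , insertPeak k (suffix (suc j) e))
  right {k} k<l = let lt = subst (suc j + k <_) (sym len) (s≤s (+-monoʳ-< j k<l)) in
    cong₂ _,_ (prefix-insertPeak-right (suc j) k e lt) (suffix-insertPeak-right (suc j) k e lt)

module _ {A B C D : Set} where

  concatMap-growLeft : (g : A → C → D) (xs : List A) (ys : List B) (zs : List C) →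
    concatMap (λ p → map (λ i → g (proj₁ p) i , proj₂ p) zs) (cartesianProduct xs ys) ↭ cartesianProduct (cartesianProductWith g xs zs) ys
  concatMap-growLeft g []       ys zs = ↭-refl
  concatMap-growLeft g (x ∷ xs) ys zs = begin
    concatMap F (map (x ,_) ys ++ cartesianProduct xs ys)
      ≡⟨ concatMap-++ F (map (x ,_) ys) _ ⟩
    concatMap F (map (x ,_) ys) ++ concatMap F (cartesianProduct xs ys)
      ≡⟨ cong (_++ concatMap F (cartesianProduct xs ys)) (concatMap-map F (x ,_) ys) ⟩
    concatMap (λ y → map (λ i → g x i , y) zs) ys ++ concatMap F (cartesianProduct xs ys)
      ↭⟨ ++⁺ row (concatMap-growLeft g xs ys zs) ⟩
    cartesianProduct (map (g x) zs) ys ++ cartesianProduct (cartesianProductWith g xs zs) ys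
      ≡⟨ cartesianProductWith-distribʳ-++ _,_ (map (g x) zs) _ ys ⟨
    cartesianProduct (cartesianProductWith g (x ∷ xs) zs) ys ∎
    where
    open PermutationReasoning
    F : A × B → List (D × B)
    F (x , y) = map (λ i → g x i , y) zs
    row : concatMap (λ y → map (λ i → g x i , y) zs) ys ↭ cartesianProduct (map (g x) zs) ys
    row = begin
      concatMap (λ y → map (λ i → g x i , y) zs) ys        ≡⟨ cartesianProductWith-concatMap (λ y i → g x i , y) ys zs ⟨
      cartesianProductWith (λ y i → g x i , y) ys zs        ↭⟨ cartesianProductWith-comm (λ y i → g x i , y) ys zs ⟩
      cartesianProductWith (λ i y → g x i , y) zs ys        ≡⟨ cartesianProductWith-mapˡ _,_ (g x) zs ys ⟨
      cartesianProduct (map (g x) zs) ys                    ∎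

  concatMap-growRight : (g : B → C → D) (xs : List A) (ys : List B) (zs : List C) →
    concatMap (λ p → map (λ k → proj₁ p , g (proj₂ p) k) zs) (cartesianProduct xs ys) ≡ cartesianProduct xs (cartesianProductWith g ys zs)
  concatMap-growRight g []       ys zs = refl
  concatMap-growRight g (x ∷ xs) ys zs = begin
    concatMap F (map (x ,_) ys ++ cartesianProduct xs ys)                          ≡⟨ concatMap-++ F (map (x ,_) ys) _ ⟩
    concatMap F (map (x ,_) ys) ++ concatMap F (cartesianProduct xs ys)             ≡⟨ cong₂ _++_ row (concatMap-growRight g xs ys zs) ⟩
    map (x ,_) (cartesianProductWith g ys zs) ++ cartesianProduct xs (cartesianProductWith g ys zs) ∎
    where
    open ≡-Reasoning
    F : A × B → List (A × D)
    F (x′ , y) = map (λ k → x′ , g y k) zs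
    row : concatMap F (map (x ,_) ys) ≡ map (x ,_) (cartesianProductWith g ys zs)
    row = begin
      concatMap F (map (x ,_) ys)                        ≡⟨ concatMap-map F (x ,_) ys ⟩
      concatMap (λ y → map (λ k → x , g y k) zs) ys      ≡⟨ cartesianProductWith-concatMap (λ y k → x , g y k) ys zs ⟨
      cartesianProductWith (λ y k → x , g y k) ys zs     ≡⟨ map-cartesianProductWith (x ,_) g ys zs ⟨
      map (x ,_) (cartesianProductWith g ys zs)          ∎

-- The binomial coefficient (j + l choose j), counting shuffles of a j-word with an l-word.
shuffles : ℕ → ℕ → ℕ
shuffles zero    l       = 1
shuffles (suc j) zero    = 1
shuffles (suc j) (suc l) = shuffles j (suc l) + shuffles (suc j) l

shuffles-zeroʳ : ∀ j → shuffles j zero ≡ 1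
shuffles-zeroʳ zero    = refl
shuffles-zeroʳ (suc j) = refl

shuffles-comm : ∀ j l → shuffles j l ≡ shuffles l j
shuffles-comm zero    l       = sym (shuffles-zeroʳ l)
shuffles-comm (suc j) zero    = refl
shuffles-comm (suc j) (suc l) = trans (cong₂ _+_ (shuffles-comm j (suc l)) (shuffles-comm (suc j) l)) (+-comm (shuffles (suc l) j) _)

map-split-suc : ∀ j l → map (split (suc j)) (DescentWords (suc j + l)) ↭
  concatMap (growLeft j) (map (split j) (DescentWords (j + l))) ++ concatMap (growRight l) (map (split (suc j)) (DescentWords (j + l)))
map-split-suc j l = begin
  map (split (suc j)) (DescentWords (suc j + l))
    ≡⟨ map-cartesianProductWith (split (suc j)) (λ e i → insertPeak i e) (D (j + l)) (upTo (suc j + l)) ⟩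
  cartesianProductWith (λ e i → split (suc j) (insertPeak i e)) (D (j + l)) (upTo (suc j + l))
    ≡⟨ cartesianProductWith-concatMap (λ e i → split (suc j) (insertPeak i e)) (D (j + l)) (upTo (suc j + l)) ⟩
  concatMap (λ e → map (λ i → split (suc j) (insertPeak i e)) (upTo (suc j + l))) (D (j + l))
    ≡⟨ concatMap-cong-All (All.map (λ (t , e≡ , len) → split-insertPeak j l _ (trans (cong length e≡) (cong suc len))) (DescentWords-Padded (j + l))) ⟩
  concatMap (λ e → growLeft j (split j e) ++ growRight l (split (suc j) e)) (D (j + l))
    ↭⟨ concatMap-split (growLeft j ∘ split j) (growRight l ∘ split (suc j)) (D (j + l)) ⟩
  concatMap (growLeft j ∘ split j) (D (j + l)) ++ concatMap (growRight l ∘ split (suc j)) (D (j + l))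
    ≡⟨ cong₂ _++_ (concatMap-map (growLeft j) (split j) (D (j + l))) (concatMap-map (growRight l) (split (suc j)) (D (j + l))) ⟨
  concatMap (growLeft j) (map (split j) (D (j + l))) ++ concatMap (growRight l) (map (split (suc j)) (D (j + l))) ∎
  where
  open PermutationReasoning
  D : ℕ → List (List Bool)
  D = DescentWords

growLeft-copies : ∀ {c} j {B : List (List Bool)} {Q} → Q ↭ copies c (cartesianProduct (DescentWords j) B) →
                  concatMap (growLeft j) Q ↭ copies c (cartesianProduct (DescentWords (suc j)) B)
growLeft-copies {c} j {B} {Q} Q↭ = begin
  concatMap (growLeft j) Q
    ↭⟨ concatMap⁺ (growLeft j) Q↭ ⟩
  concatMap (growLeft j) (copies c (cartesianProduct (DescentWords j) B))
    ≡⟨ concatMap-copies (growLeft j) c _ ⟩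
  copies c (concatMap (growLeft j) (cartesianProduct (DescentWords j) B))
    ↭⟨ copies⁺ c (concatMap-growLeft (λ e i → insertPeak i e) (DescentWords j) B (upTo (suc j))) ⟩
  copies c (cartesianProduct (DescentWords (suc j)) B) ∎
  where open PermutationReasoning

growRight-copies : ∀ {c} l {A : List (List Bool)} {Q} → Q ↭ copies c (cartesianProduct A (DescentWords l)) →
                   concatMap (growRight (suc l)) Q ↭ copies c (cartesianProduct A (DescentWords (suc l)))
growRight-copies {c} l {A} {Q} Q↭ = begin
  concatMap (growRight (suc l)) Q
    ↭⟨ concatMap⁺ (growRight (suc l)) Q↭ ⟩
  concatMap (growRight (suc l)) (copies c (cartesianProduct A (DescentWords l)))
    ≡⟨ concatMap-copies (growRight (suc l)) c _ ⟩
  copies c (concatMap (growRight (suc l)) (cartesianProduct A (DescentWords l)))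
    ≡⟨ cong (copies c) (concatMap-growRight (λ e i → insertPeak i e) A (DescentWords l) (upTo (suc l))) ⟩
  copies c (cartesianProduct A (DescentWords (suc l))) ∎
  where open PermutationReasoning

-- Cutting the words of DescentWords (j + l) after j letters hits every pair of words of
-- DescentWords j and DescentWords l equally often: once per choice of the j values on the left.
map-split-DescentWords : ∀ j l → map (split j) (DescentWords (j + l)) ↭ copies (shuffles j l) (cartesianProduct (DescentWords j) (DescentWords l))
map-split-DescentWords zero    l = ↭-reflexive (begin
  map (split 0) (DescentWords l)                  ≡⟨ map-cong-All (All.map split-zero (DescentWords-Padded l)) ⟩
  map ([ false ] ,_) (DescentWords l)              ≡⟨ ++-identityʳ _ ⟨
  cartesianProduct [ [ false ] ] (DescentWords l) ≡⟨ ++-identityʳ _ ⟨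
  copies 1 (cartesianProduct [ [ false ] ] (DescentWords l)) ∎)
  where open ≡-Reasoning
map-split-DescentWords (suc j) zero = begin
  map (split (suc j)) (DescentWords (suc j + 0))
    ↭⟨ map-split-suc j 0 ⟩
  left ++ concatMap (growRight 0) (map (split (suc j)) (DescentWords (j + 0)))
    ≡⟨ cong (left ++_) (concatMap-[] (map (split (suc j)) (DescentWords (j + 0)))) ⟩
  left ++ []
    ≡⟨ ++-identityʳ left ⟩
  left
    ↭⟨ growLeft-copies {shuffles j 0} j {DescentWords 0} (map-split-DescentWords j 0) ⟩
  copies (shuffles j 0) P
    ≡⟨ cong (λ c → copies c P) (shuffles-zeroʳ j) ⟩
  copies 1 P ∎
  where
  open PermutationReasoning
  left : List (List Bool × List Bool)
  left = concatMap (growLeft j) (map (split j) (DescentWords (j + 0)))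
  P : List (List Bool × List Bool)
  P = cartesianProduct (DescentWords (suc j)) (DescentWords 0)
map-split-DescentWords (suc j) (suc l) = begin
  map (split (suc j)) (DescentWords (suc j + suc l))
    ↭⟨ map-split-suc j (suc l) ⟩
  concatMap (growLeft j) (map (split j) (DescentWords (j + suc l))) ++ concatMap (growRight (suc l)) (map (split (suc j)) (DescentWords (j + suc l)))
    ↭⟨ ++⁺ (growLeft-copies {shuffles j (suc l)} j {DescentWords (suc l)} (map-split-DescentWords j (suc l)))
          (growRight-copies {shuffles (suc j) l} l {DescentWords (suc j)} right) ⟩
  copies (shuffles j (suc l)) P ++ copies (shuffles (suc j) l) P
    ≡⟨ copies-+ (shuffles j (suc l)) _ P ⟨
  copies (shuffles (suc j) (suc l)) P ∎
  where
  open PermutationReasoning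
  P : List (List Bool × List Bool)
  P = cartesianProduct (DescentWords (suc j)) (DescentWords (suc l))
  R : List (List Bool × List Bool)
  R = copies (shuffles (suc j) l) (cartesianProduct (DescentWords (suc j)) (DescentWords l))
  right : map (split (suc j)) (DescentWords (j + suc l)) ↭ R
  right = subst (λ m → map (split (suc j)) (DescentWords m) ↭ R) (sym (+-suc j l)) (map-split-DescentWords (suc j) l)

join : List Bool × List Bool → List Bool
join (a , b) = dropLast a ++ false ∷ true ∷ drop 1 b

dropLast-∷ʳ : ∀ xs x → dropLast (xs ++ [ x ]) ≡ xs
dropLast-∷ʳ []          x = refl
dropLast-∷ʳ (y ∷ [])    x = refl
dropLast-∷ʳ (y ∷ z ∷ w) x = cong (y ∷_) (dropLast-∷ʳ (z ∷ w) x)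

dropLast-++ : ∀ xs y ys → dropLast (xs ++ y ∷ ys) ≡ xs ++ dropLast (y ∷ ys)
dropLast-++ []          y ys = refl
dropLast-++ (x ∷ [])    y ys = refl
dropLast-++ (x ∷ z ∷ w) y ys = cong (x ∷_) (dropLast-++ (z ∷ w) y ys)

length-dropLast : ∀ xs → length (dropLast xs) ≡ pred (length xs)
length-dropLast []          = refl
length-dropLast (x ∷ [])    = refl
length-dropLast (x ∷ y ∷ w) = cong suc (length-dropLast (y ∷ w))

insertPeak≡join-split : ∀ i e → insertPeak i e ≡ join (split i e)
insertPeak≡join-split zero    []      = refl
insertPeak≡join-split zero    (c ∷ e) = refl
insertPeak≡join-split (suc i) e       = cong (_++ false ∷ true ∷ drop (suc (suc i)) e) (sym (dropLast-∷ʳ (take (suc i) e) true))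

-- Grouping the words of DescentWords (n + 1) by the position k of the new maximum.
map-DescentWords-suc : ∀ {B : Set} (φ : List Bool → B) n → map φ (DescentWords (suc n)) ↭
  concatMap (λ k → copies (shuffles k (n ∸ k)) (map (φ ∘ join) (cartesianProduct (DescentWords k) (DescentWords (n ∸ k))))) (upTo (suc n))
map-DescentWords-suc φ n = begin
  map φ (DescentWords (suc n))
    ≡⟨ map-cartesianProductWith φ (λ e i → insertPeak i e) (DescentWords n) (upTo (suc n)) ⟩
  cartesianProductWith (λ e i → φ (insertPeak i e)) (DescentWords n) (upTo (suc n))
    ↭⟨ cartesianProductWith-comm (λ e i → φ (insertPeak i e)) (DescentWords n) (upTo (suc n)) ⟩
  cartesianProductWith (λ i e → φ (insertPeak i e)) (upTo (suc n)) (DescentWords n)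
    ≡⟨ cartesianProductWith-concatMap (λ i e → φ (insertPeak i e)) (upTo (suc n)) (DescentWords n) ⟩
  concatMap (λ i → map (λ e → φ (insertPeak i e)) (DescentWords n)) (upTo (suc n))
    ↭⟨ concatMap-↭ (All.map (λ i<1+n → cut (≤-pred i<1+n)) (upTo-< (suc n))) ⟩
  concatMap (λ k → copies (shuffles k (n ∸ k)) (map (φ ∘ join) (Pieces k (n ∸ k)))) (upTo (suc n)) ∎
  where
  open PermutationReasoning
  Pieces : ℕ → ℕ → List (List Bool × List Bool)
  Pieces k l = cartesianProduct (DescentWords k) (DescentWords l)
  cut : ∀ {k} → k ≤ n → map (λ e → φ (insertPeak k e)) (DescentWords n) ↭ copies (shuffles k (n ∸ k)) (map (φ ∘ join) (Pieces k (n ∸ k)))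
  cut {k} k≤n = begin
    map (λ e → φ (insertPeak k e)) (DescentWords n)
      ≡⟨ map-cong (λ e → cong φ (insertPeak≡join-split k e)) (DescentWords n) ⟩
    map (φ ∘ join ∘ split k) (DescentWords n)
      ≡⟨ map-∘ (DescentWords n) ⟩
    map (φ ∘ join) (map (split k) (DescentWords n))
      ≡⟨ cong (λ m → map (φ ∘ join) (map (split k) (DescentWords m))) (m+[n∸m]≡n k≤n) ⟨
    map (φ ∘ join) (map (split k) (DescentWords (k + (n ∸ k))))
      ↭⟨ map⁺ (φ ∘ join) (map-split-DescentWords k (n ∸ k)) ⟩
    map (φ ∘ join) (copies (shuffles k (n ∸ k)) (Pieces k (n ∸ k)))
      ≡⟨ map-copies (φ ∘ join) (shuffles k (n ∸ k)) (Pieces k (n ∸ k)) ⟩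
    copies (shuffles k (n ∸ k)) (map (φ ∘ join) (Pieces k (n ∸ k))) ∎

-- The statistic of a permutation whose maximum sits after k letters with l letters to its right,
-- from those of the two pieces: the maximum adds a descent at position k + 1 unless l = 0, and the
-- right piece is shifted by k + 1 positions.
glue : ℕ → ℕ → Stat → Stat → Stat
glue k zero    x y = x
glue k (suc l) x y = x ⊕ unitAt (suc k) ⊕ flipBy (suc k) y

padStat-join : ∀ {k l a b} → Padded k a → Padded l b → padStat (join (a , b)) ≡ glue k l (padStat a) (padStat b)
padStat-join {k} {zero} {a} _ ([] , refl , _) = begin
  count 0 (dropLast (dropLast a ++ false ∷ true ∷ []))           ≡⟨ cong (count 0) (dropLast-++ (dropLast a) false (true ∷ [])) ⟩
  count 0 (dropLast a ++ [ false ])                             ≡⟨ count-++ 0 (dropLast a) [ false ] ⟩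
  count 0 (dropLast a) ⊕ (0 , 0)                                ≡⟨ ⊕-identityʳ (count 0 (dropLast a)) ⟩
  count 0 (dropLast a)                                          ∎
  where open ≡-Reasoning
padStat-join {k} {suc l} {a} (t , refl , len) (c ∷ u , refl , _) = begin
  count 0 (dropLast (dropLast a ++ false ∷ true ∷ c ∷ u))
    ≡⟨ cong (count 0) (dropLast-++ (dropLast a) false (true ∷ c ∷ u)) ⟩
  count 0 (dropLast a ++ false ∷ true ∷ Y)
    ≡⟨ count-++ 0 (dropLast a) (false ∷ true ∷ Y) ⟩
  count 0 (dropLast a) ⊕ count (length (dropLast a) + 0) (false ∷ true ∷ Y)
    ≡⟨ cong (λ s → count 0 (dropLast a) ⊕ count s (false ∷ true ∷ Y)) length-k ⟩
  count 0 (dropLast a) ⊕ unitAt (suc k) ⊕ count (2 + k) Y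
    ≡⟨ cong (λ s → count 0 (dropLast a) ⊕ unitAt (suc k) ⊕ count s Y) (+-comm 1 (suc k)) ⟩
  count 0 (dropLast a) ⊕ unitAt (suc k) ⊕ count (suc k + 1) Y
    ≡⟨ cong (λ y → count 0 (dropLast a) ⊕ unitAt (suc k) ⊕ y) (count-+ (suc k) 1 Y) ⟩
  count 0 (dropLast a) ⊕ unitAt (suc k) ⊕ flipBy (suc k) (count 1 Y) ∎
  where
  open ≡-Reasoning
  Y : List Bool
  Y = dropLast (c ∷ u)
  length-k : length (dropLast a) + 0 ≡ k
  length-k = trans (+-identityʳ _) (trans (length-dropLast a) len)

Stats-suc : ∀ n → Stats (suc n) ↭
  concatMap (λ k → copies (shuffles k (n ∸ k)) (cartesianProductWith (glue k (n ∸ k)) (Stats k) (Stats (n ∸ k)))) (upTo (suc n))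
Stats-suc n = begin
  Stats (suc n)
    ↭⟨ Stats↭map-padStat (suc n) ⟩
  map padStat (DescentWords (suc n))
    ↭⟨ map-DescentWords-suc padStat n ⟩
  concatMap (λ k → copies (shuffles k (n ∸ k)) (map (padStat ∘ join) (cartesianProduct (DescentWords k) (DescentWords (n ∸ k))))) (upTo (suc n))
    ↭⟨ concatMap-↭ (All.universal (λ k → copies⁺ (shuffles k (n ∸ k)) (glued k (n ∸ k))) (upTo (suc n))) ⟩
  concatMap (λ k → copies (shuffles k (n ∸ k)) (cartesianProductWith (glue k (n ∸ k)) (Stats k) (Stats (n ∸ k)))) (upTo (suc n)) ∎
  where
  open PermutationReasoning
  glued : ∀ k l → map (padStat ∘ join) (cartesianProduct (DescentWords k) (DescentWords l)) ↭ cartesianProductWith (glue k l) (Stats k) (Stats l)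
  glued k l = begin
    map (padStat ∘ join) (cartesianProduct (DescentWords k) (DescentWords l))
      ≡⟨ map-cartesianProductWith (padStat ∘ join) _,_ (DescentWords k) (DescentWords l) ⟩
    cartesianProductWith (λ a b → padStat (join (a , b))) (DescentWords k) (DescentWords l)
      ≡⟨ cartesianProductWith-cong-All (All.map (λ pa → All.map (padStat-join pa) (DescentWords-Padded l)) (DescentWords-Padded k)) ⟩
    cartesianProductWith (λ a b → glue k l (padStat a) (padStat b)) (DescentWords k) (DescentWords l)
      ≡⟨ cartesianProductWith-mapʳ (λ a → glue k l (padStat a)) padStat (DescentWords k) (DescentWords l) ⟨
    cartesianProductWith (λ a → glue k l (padStat a)) (DescentWords k) (map padStat (DescentWords l))
      ≡⟨ cartesianProductWith-mapˡ (glue k l) padStat (DescentWords k) _ ⟨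
    cartesianProductWith (glue k l) (map padStat (DescentWords k)) (map padStat (DescentWords l))
      ↭⟨ cartesianProductWith⁺ˡ (glue k l) _ (↭-sym (Stats↭map-padStat k)) ⟩
    cartesianProductWith (glue k l) (Stats k) (map padStat (DescentWords l))
      ↭⟨ cartesianProductWith⁺ʳ (glue k l) (Stats k) (↭-sym (Stats↭map-padStat l)) ⟩
    cartesianProductWith (glue k l) (Stats k) (Stats l) ∎

-- Complement and reversal

complement : ℕ → List ℕ → List ℕ
complement n = map (suc n ∸_)

complement-IsPermutation : ∀ {n π} → IsPermutation n π → IsPermutation n (complement n π)
complement-IsPermutation {n} {π} (isPermutation len bnds uniq) = isPermutation
  (trans (length-map (suc n ∸_) π) len)
  (AllP.map⁺ (All.map (λ { {suc x} (_ , x<n) → 1≤∸ x<n , m∸n≤m n x }) bnds))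
  (Unique.map⁻ (subst Unique (sym (complement-involutive-on bnds)) uniq))
  where
  1≤∸ : ∀ {n x} → x < n → 1 ≤ n ∸ x
  1≤∸ {suc n} {zero}  _         = s≤s z≤n
  1≤∸ {suc n} {suc x} (s≤s x<n) = 1≤∸ x<n
  complement-involutive-on : ∀ {w} → All (InRange n) w → complement n (complement n w) ≡ w
  complement-involutive-on []                 = refl
  complement-involutive-on ((_ , x≤n) ∷ bnds) = cong₂ _∷_ (m∸[m∸n]≡n (m≤n⇒m≤1+n x≤n)) (complement-involutive-on bnds)

complement-involutive : ∀ {n π} → IsPermutation n π → complement n (complement n π) ≡ π
complement-involutive {n} {π} (isPermutation _ bnds _) =
  trans (sym (map-∘ π)) (trans (map-cong-All (All.map (λ (_ , x≤n) → m∸[m∸n]≡n (m≤n⇒m≤1+n x≤n)) bnds)) (map-id π))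

reverse-IsPermutation : ∀ {n π} → IsPermutation n π → IsPermutation n (reverse π)
reverse-IsPermutation {n} {π} (isPermutation len bnds uniq) = isPermutation
  (trans (length-reverse π) len) (All-resp-↭ (↭-sym (↭-reverse π)) bnds) (Unique-resp-↭ (↭-sym (↭-reverse π)) uniq)

-- The statistic of the decreasing permutation: every one of the n - 1 positions is a descent.
maxStat : ℕ → Stat
maxStat n = count 1 (replicate (pred n) true)

length-descents-perm : ∀ {n π} → IsPermutation n π → length (descents π) ≡ pred n
length-descents-perm {π = π} p = trans (length-descents π) (cong pred (IsPermutation.length≡ p))

descents-complement : ∀ {n π} → IsPermutation n π → descents (complement n π) ≡ map not (descents π)
descents-complement (isPermutation _ bnds uniq) = descents-map-∸ (All.map (λ (_ , x≤n) → m≤n⇒m≤1+n x≤n) bnds) uniq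

stat-complement : ∀ {n π} → IsPermutation n π → stat π ⊕ stat (complement n π) ≡ maxStat n
stat-complement {n} {π} p = begin
  stat π ⊕ stat (complement n π)
    ≡⟨ cong₂ _⊕_ (stat≡count-descents π) (stat≡count-descents (complement n π)) ⟩
  count 1 (descents π) ⊕ count 1 (descents (complement n π))
    ≡⟨ cong (λ d → count 1 (descents π) ⊕ count 1 d) (descents-complement p) ⟩
  count 1 (descents π) ⊕ count 1 (map not (descents π))
    ≡⟨ count-complement 1 (descents π) ⟩
  count 1 (replicate (length (descents π)) true)
    ≡⟨ cong (λ L → count 1 (replicate L true)) (length-descents-perm p) ⟩
  maxStat n ∎
  where open ≡-Reasoning

stat-reverse-complement : ∀ {k π} → IsPermutation (suc (k + k)) π → stat (reverse (complement (suc (k + k)) π)) ≡ swap (stat π)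
stat-reverse-complement {k} {π} p = begin
  stat (reverse σ)
    ≡⟨ stat≡count-descents (reverse σ) ⟩
  count 1 (descents (reverse σ))
    ≡⟨ cong (count 1) (descents-reverse σ (IsPermutation.unique (complement-IsPermutation p))) ⟩
  count 1 (reverse (map not (descents σ)))
    ≡⟨ cong (λ d → count 1 (reverse (map not d))) (descents-complement p) ⟩
  count 1 (reverse (map not (map not (descents π))))
    ≡⟨ cong (λ d → count 1 (reverse d)) not-not ⟩
  count 1 (reverse (descents π))
    ≡⟨ count-reverse 1 (descents π) ⟩
  flipBy (suc (length (descents π))) (count 1 (descents π))
    ≡⟨ cong (λ L → flipBy (suc L) (count 1 (descents π))) (length-descents-perm p) ⟩
  swap (flipBy (k + k) (count 1 (descents π)))
    ≡⟨ cong swap (flipBy-double k _) ⟩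
  swap (count 1 (descents π))
    ≡⟨ cong swap (stat≡count-descents π) ⟨
  swap (stat π) ∎
  where
  open ≡-Reasoning
  σ : List ℕ
  σ = complement (suc (k + k)) π
  not-not : map not (map not (descents π)) ≡ descents π
  not-not = trans (sym (map-∘ (descents π))) (trans (map-cong not-involutive (descents π)) (map-id (descents π)))

Stats-swap-odd : ∀ k → map swap (Stats (suc (k + k))) ↭ Stats (suc (k + k))
Stats-swap-odd k = begin
  map swap (map stat (Sym n))             ≡⟨ map-∘ (Sym n) ⟨
  map (swap ∘ stat) (Sym n)               ≡⟨ map-cong-All (All.map (λ p → sym (stat-reverse-complement {k} p)) (Sym-IsPermutation n)) ⟩
  map (stat ∘ reverse-complement) (Sym n) ≡⟨ map-∘ (Sym n) ⟩
  map stat (map reverse-complement (Sym n)) ↭⟨ map⁺ stat (map-Sym-involution n reverse-complement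
                                                (reverse-IsPermutation ∘ complement-IsPermutation) involutive) ⟩
  map stat (Sym n)                        ∎
  where
  open PermutationReasoning
  n : ℕ
  n = suc (k + k)
  reverse-complement : List ℕ → List ℕ
  reverse-complement = reverse ∘ complement n
  involutive : ∀ {π} → IsPermutation n π → reverse-complement (reverse-complement π) ≡ π
  involutive {π} p = trans (cong reverse (reverse-map (suc n ∸_) (complement n π)))
                           (trans (reverse-involutive _) (complement-involutive p))

map-stat-complement : ∀ n → map (stat ∘ complement n) (Sym n) ↭ Stats n
map-stat-complement n = ↭-trans (↭-reflexive (map-∘ (Sym n)))
  (map⁺ stat (map-Sym-involution n (complement n) complement-IsPermutation complement-involutive))

-- Symmetry of (1 + q) A_n for even n

IsSymmetric : List Stat → Set
IsSymmetric X = map swap X ↭ X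

IsSymmetric-resp-↭ : ∀ {X Y} → X ↭ Y → IsSymmetric X → IsSymmetric Y
IsSymmetric-resp-↭ X↭Y sym-X = ↭-trans (map⁺ swap (↭-sym X↭Y)) (↭-trans sym-X X↭Y)

IsSymmetric-++ : ∀ {X Y} → IsSymmetric X → IsSymmetric Y → IsSymmetric (X ++ Y)
IsSymmetric-++ {X} {Y} sym-X sym-Y = ↭-trans (↭-reflexive (map-++ swap X Y)) (++⁺ sym-X sym-Y)

map-swap-swap : (X : List Stat) → map swap (map swap X) ≡ X
map-swap-swap X = trans (sym (map-∘ X)) (map-id X)

map-concatMap-reflect : {A : Set} (f : A → A) (V : ℕ → List A) (n : ℕ) →
  (∀ {i} → i < n → map f (V i) ↭ V (n ∸ suc i)) → map f (concatMap V (upTo n)) ↭ concatMap V (upTo n)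
map-concatMap-reflect f V n reflect = begin
  map f (concatMap V (upTo n))                   ≡⟨ map-concatMap f V (upTo n) ⟩
  concatMap (map f ∘ V) (upTo n)                 ↭⟨ concatMap-↭ (All.map reflect (upTo-< n)) ⟩
  concatMap (V ∘ (λ i → n ∸ suc i)) (upTo n)     ≡⟨ concatMap-map V (λ i → n ∸ suc i) (upTo n) ⟨
  concatMap V (map (λ i → n ∸ suc i) (upTo n))   ≡⟨ cong (concatMap V) (trans (map-upTo _ n) (sym (applyDownFrom≡applyUpTo id n))) ⟩
  concatMap V (applyDownFrom id n)               ≡⟨ cong (concatMap V) (reverse-applyUpTo id n) ⟨
  concatMap V (reverse (upTo n))                 ↭⟨ concatMap⁺ V (↭-reverse (upTo n)) ⟩
  concatMap V (upTo n)                           ∎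
  where open PermutationReasoning

timesP timesQ : Stat → Stat
timesP (a , b) = suc a , b
timesQ (a , b) = a , suc b

-- Multiplication by 1 + q, as an operation on multisets of exponent pairs.
withQ : List Stat → List Stat
withQ X = X ++ map timesQ X

withQ⁺ : ∀ {X Y} → X ↭ Y → withQ X ↭ withQ Y
withQ⁺ X↭Y = ++⁺ X↭Y (map⁺ timesQ X↭Y)

withQ-++ : ∀ X Y → withQ (X ++ Y) ↭ withQ X ++ withQ Y
withQ-++ X Y = begin
  (X ++ Y) ++ map timesQ (X ++ Y)           ≡⟨ cong ((X ++ Y) ++_) (map-++ timesQ X Y) ⟩
  (X ++ Y) ++ map timesQ X ++ map timesQ Y  ≡⟨ ++-assoc X Y _ ⟩
  X ++ Y ++ map timesQ X ++ map timesQ Y    ↭⟨ ++⁺ˡ X (shifts Y (map timesQ X)) ⟩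
  X ++ map timesQ X ++ Y ++ map timesQ Y    ≡⟨ ++-assoc X (map timesQ X) _ ⟨
  withQ X ++ withQ Y                         ∎
  where open PermutationReasoning

withQ-concatMap : (V : ℕ → List Stat) (I : List ℕ) → withQ (concatMap V I) ↭ concatMap (withQ ∘ V) I
withQ-concatMap V []      = ↭-refl
withQ-concatMap V (i ∷ I) = ↭-trans (withQ-++ (V i) (concatMap V I)) (++⁺ˡ (withQ (V i)) (withQ-concatMap V I))

withQ-copies : ∀ c X → withQ (copies c X) ↭ copies c (withQ X)
withQ-copies c X = ↭-trans (↭-reflexive (cong (copies c X ++_) (map-copies timesQ c X))) (↭-sym (copies-++ c X (map timesQ X)))

withQ-cartesianProductWithʳ : {A : Set} (f : A → Stat → Stat) (xs : List A) (Y : List Stat) → (∀ x y → timesQ (f x y) ≡ f x (timesQ y)) →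
  withQ (cartesianProductWith f xs Y) ↭ cartesianProductWith f xs (withQ Y)
withQ-cartesianProductWithʳ f xs Y commutes = begin
  cartesianProductWith f xs Y ++ map timesQ (cartesianProductWith f xs Y)
    ≡⟨ cong (cartesianProductWith f xs Y ++_) (trans (map-cartesianProductWith timesQ f xs Y)
         (trans (cartesianProductWith-cong xs Y commutes) (sym (cartesianProductWith-mapʳ f timesQ xs Y)))) ⟩
  cartesianProductWith f xs Y ++ cartesianProductWith f xs (map timesQ Y) ↭⟨ cartesianProductWith-distribˡ-++ f xs Y (map timesQ Y) ⟨
  cartesianProductWith f xs (withQ Y)                                     ∎
  where open PermutationReasoning

withQ-cartesianProductWithˡ : {B : Set} (f : Stat → B → Stat) (X : List Stat) (ys : List B) → (∀ x y → timesQ (f x y) ≡ f (timesQ x) y) →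
  withQ (cartesianProductWith f X ys) ≡ cartesianProductWith f (withQ X) ys
withQ-cartesianProductWithˡ f X ys commutes = begin
  cartesianProductWith f X ys ++ map timesQ (cartesianProductWith f X ys)
    ≡⟨ cong (cartesianProductWith f X ys ++_) (trans (map-cartesianProductWith timesQ f X ys)
         (trans (cartesianProductWith-cong X ys commutes) (sym (cartesianProductWith-mapˡ f timesQ X ys)))) ⟩
  cartesianProductWith f X ys ++ cartesianProductWith f (map timesQ X) ys ≡⟨ cartesianProductWith-distribʳ-++ f X (map timesQ X) ys ⟨
  cartesianProductWith f (withQ X) ys                                     ∎
  where open ≡-Reasoning

-- The contribution to (1 + q) A_{k + l + 1} of the permutations with k letters before the maximum.
block : ℕ → ℕ → List Stat
block k l = withQ (copies (shuffles k l) (cartesianProductWith (glue k l) (Stats k) (Stats l)))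

withQ-Stats-suc : ∀ n → withQ (Stats (suc n)) ↭ concatMap (λ k → block k (n ∸ k)) (upTo (suc n))
withQ-Stats-suc n = ↭-trans (withQ⁺ (Stats-suc n))
  (withQ-concatMap (λ k → copies (shuffles k (n ∸ k)) (cartesianProductWith (glue k (n ∸ k)) (Stats k) (Stats (n ∸ k)))) (upTo (suc n)))

glue-odd : ∀ a l x y → glue (suc (a + a)) (suc l) x y ≡ x ⊕ (0 , 1) ⊕ y
glue-odd a l x y = cong₂ (λ u v → x ⊕ u ⊕ v) (flipBy-double a (0 , 1)) (flipBy-double a y)

glue-even : ∀ b l y x → glue (suc (suc (b + b))) (suc l) y x ≡ y ⊕ (1 , 0) ⊕ swap x
glue-even b l y x = cong₂ (λ u v → y ⊕ swap u ⊕ swap v) (flipBy-double b (0 , 1)) (flipBy-double b x)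

-- With k odd and l even, the factor 1 + q can be attached to the even piece; the symmetry of
-- (1 + q) A_l then turns the block of (k, l) into the block of (l, k) with p and q exchanged.
block-odd-even : ∀ a b → IsSymmetric (withQ (Stats (suc (suc (b + b))))) →
  map swap (block (suc (a + a)) (suc (suc (b + b)))) ↭ block (suc (suc (b + b))) (suc (a + a))
block-odd-even a b sym-l = begin
  map swap (block k l)
    ↭⟨ map⁺ swap (↭-trans (withQ-copies c _) (copies⁺ c left)) ⟩
  map swap (copies c (cartesianProductWith gk (Stats k) Wl))
    ≡⟨ trans (map-copies swap c _) (cong (copies c) (map-cartesianProductWith swap gk (Stats k) Wl)) ⟩
  copies c (cartesianProductWith (λ x y → swap (gk x y)) (Stats k) Wl)
    ≡⟨ cong (copies c) (cartesianProductWith-mapʳ g swap (Stats k) Wl) ⟨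
  copies c (cartesianProductWith g (Stats k) (map swap Wl))
    ↭⟨ copies⁺ c (cartesianProductWith⁺ʳ g (Stats k) sym-l) ⟩
  copies c (cartesianProductWith g (Stats k) Wl)
    ↭⟨ copies⁺ c (cartesianProductWith-comm g (Stats k) Wl) ⟩
  copies c (cartesianProductWith (λ y x → g x y) Wl (Stats k))
    ≡⟨ cong₂ copies (shuffles-comm k l) (cartesianProductWith-cong Wl (Stats k) g≡gl) ⟩
  copies (shuffles l k) (cartesianProductWith gl Wl (Stats k))
    ≡⟨ cong (copies (shuffles l k)) right ⟨
  copies (shuffles l k) (withQ (cartesianProductWith (glue l k) (Stats l) (Stats k)))
    ↭⟨ withQ-copies (shuffles l k) _ ⟨
  block l k ∎
  where
  open PermutationReasoning
  k l c : ℕ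
  k = suc (a + a)
  l = suc (suc (b + b))
  c = shuffles k l
  Wl : List Stat
  Wl = withQ (Stats l)
  gk gl g : Stat → Stat → Stat
  gk x y = x ⊕ (0 , 1) ⊕ y
  gl y x = y ⊕ (1 , 0) ⊕ swap x
  g x y = swap x ⊕ (1 , 0) ⊕ y
  left : withQ (cartesianProductWith (glue k l) (Stats k) (Stats l)) ↭ cartesianProductWith gk (Stats k) Wl
  left = ↭-trans (withQ⁺ (↭-reflexive (cartesianProductWith-cong (Stats k) (Stats l) (glue-odd a (suc (b + b))))))
                 (withQ-cartesianProductWithʳ gk (Stats k) (Stats l) (λ x y → cong₂ _,_ refl (sym (+-suc (proj₂ x) _))))
  right : withQ (cartesianProductWith (glue l k) (Stats l) (Stats k)) ≡ cartesianProductWith gl Wl (Stats k)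
  right = trans (cong withQ (cartesianProductWith-cong (Stats l) (Stats k) (glue-even b (a + a))))
                (withQ-cartesianProductWithˡ gl (Stats l) (Stats k) (λ _ _ → refl))
  g≡gl : ∀ y x → g x y ≡ gl y x
  g≡gl y x = trans (⊕-middle (swap x) (1 , 0) y) (trans (cong ((1 , 0) ⊕_) (⊕-comm (swap x) y)) (⊕-middle (1 , 0) y (swap x)))

data Parity : ℕ → Set where
  even : ∀ h → Parity (h + h)
  odd  : ∀ h → Parity (suc (h + h))

parity : ∀ n → Parity n
parity zero = even 0
parity (suc n) with parity n
... | even h = odd h
... | odd  h = subst Parity (cong suc (+-suc h h)) (even (suc h))

halve-< : ∀ {a h} → a + a < h + h → a < h
halve-< {a} {h} lt with a <? h
... | yes a<h = a<h
... | no  a≮h = ⊥-elim (<⇒≱ lt (+-mono-≤ (≮⇒≥ a≮h) (≮⇒≥ a≮h)))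

halve-suc-< : ∀ {a h} → suc (a + a) < h + h → a < h
halve-suc-< {a} lt = halve-< (<-trans (n<1+n (a + a)) lt)

double-∸ : ∀ {a h} → a < h → Σ ℕ λ b → b < h × (h + h) ∸ (a + a) ≡ suc (suc (b + b)) × (h + h) ∸ suc (a + a) ≡ suc (b + b)
double-∸ {zero}  {suc h} _ = h , ≤-refl , cong suc (+-suc h h) , +-suc h h
double-∸ {suc a} {suc h} (s≤s a<h) =
  let b , b<h , e₁ , e₂ = double-∸ a<h in
  b , m≤n⇒m≤1+n b<h , trans (cong₂ _∸_ (+-suc h h) (+-suc a a)) e₁ , trans (cong₂ (λ u v → u ∸ suc v) (+-suc h h) (+-suc a a)) e₂

-- For symmetric S this is the multiset of (1 + p) (1 + q) S.
ends-symmetric : ∀ {S} → IsSymmetric S → IsSymmetric (withQ (map (timesP ∘ swap) S) ++ withQ S)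
ends-symmetric {S} sym-S = begin
  map swap ((pS ++ pqS) ++ (S ++ qS))
    ≡⟨ trans (map-++ swap (pS ++ pqS) _) (cong₂ _++_ (map-++ swap pS pqS) (map-++ swap S qS)) ⟩
  (map swap pS ++ map swap pqS) ++ (map swap S ++ map swap qS)
    ≡⟨ cong₂ (λ u v → (u ++ map swap pqS) ++ (map swap S ++ v)) (sym (map-∘ S)) (sym (map-∘ S)) ⟩
  (qS ++ map swap pqS) ++ (map swap S ++ pS)
    ↭⟨ ++⁺ (++⁺ˡ qS swap-pqS) (++⁺ʳ pS sym-S) ⟩
  (qS ++ pqS) ++ (S ++ pS)
    ↭⟨ exchange-outer qS pqS S pS ⟩
  (pS ++ pqS) ++ (S ++ qS) ∎
  where
  open PermutationReasoning
  pS pqS qS : List Stat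
  pS = map (timesP ∘ swap) S
  pqS = map timesQ pS
  qS = map timesQ S
  timesPQ : Stat → Stat
  timesPQ (a , b) = suc a , suc b
  swap-pqS : map swap pqS ↭ pqS
  swap-pqS = begin
    map swap pqS              ≡⟨ trans (sym (map-∘ pS)) (sym (map-∘ S)) ⟩
    map timesPQ S             ↭⟨ map⁺ timesPQ (↭-sym sym-S) ⟩
    map timesPQ (map swap S)  ≡⟨ trans (sym (map-∘ S)) (map-∘ {g = timesQ} {f = timesP ∘ swap} S) ⟩
    pqS                       ∎
  exchange-outer : (a b c d : List Stat) → (a ++ b) ++ (c ++ d) ↭ (d ++ b) ++ (c ++ a)
  exchange-outer a b c d = begin
    (a ++ b) ++ (c ++ d)  ≡⟨ ++-assoc a b _ ⟩
    a ++ b ++ c ++ d      ↭⟨ ++-comm a (b ++ c ++ d) ⟩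
    (b ++ c ++ d) ++ a    ≡⟨ trans (++-assoc b _ a) (cong (b ++_) (++-assoc c d a)) ⟩
    b ++ c ++ d ++ a      ≡⟨ ++-assoc b c _ ⟨
    (b ++ c) ++ d ++ a    ↭⟨ shifts (b ++ c) d ⟩
    d ++ (b ++ c) ++ a    ≡⟨ cong (d ++_) (++-assoc b c a) ⟩
    d ++ b ++ c ++ a      ≡⟨ ++-assoc d b _ ⟨
    (d ++ b) ++ (c ++ a)  ∎

cartesianProductWith-const : {A B : Set} (X : List A) (y : B) → cartesianProductWith (λ x _ → x) X [ y ] ≡ X
cartesianProductWith-const []      y = refl
cartesianProductWith-const (x ∷ X) y = cong (x ∷_) (cartesianProductWith-const X y)

-- (1 + q) A_{2h+2} splits into the blocks with the maximum first or last and the middle blocks.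
withQ-Stats-even : ∀ M → withQ (Stats (suc (suc M))) ↭
  (withQ (map (timesP ∘ swap) (Stats (suc M))) ++ withQ (Stats (suc M))) ++ concatMap (λ i → block (suc i) (M ∸ i)) (upTo M)
withQ-Stats-even M = begin
  withQ (Stats (suc N))
    ↭⟨ withQ-Stats-suc N ⟩
  block 0 N ++ concatMap blk (applyUpTo suc (suc M))
    ≡⟨ cong (λ is → block 0 N ++ concatMap blk is) (sym (applyUpTo-∷ʳ suc M)) ⟩
  block 0 N ++ concatMap blk (applyUpTo suc M ++ [ N ])
    ≡⟨ cong (block 0 N ++_) (concatMap-++ blk (applyUpTo suc M) [ N ]) ⟩
  block 0 N ++ Mid ++ block N (N ∸ N) ++ []
    ≡⟨ cong (λ X → block 0 N ++ Mid ++ X) (trans (++-identityʳ _) (cong (block N) (n∸n≡0 N))) ⟩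
  block 0 N ++ Mid ++ block N 0
    ↭⟨ ++⁺ˡ (block 0 N) (++-comm Mid (block N 0)) ⟩
  block 0 N ++ block N 0 ++ Mid
    ≡⟨ ++-assoc (block 0 N) (block N 0) Mid ⟨
  (block 0 N ++ block N 0) ++ Mid
    ≡⟨ cong₂ _++_ (cong₂ (λ u v → withQ u ++ withQ v) first last) middle ⟩
  (withQ (map (timesP ∘ swap) (Stats N)) ++ withQ (Stats N)) ++ concatMap (λ i → block (suc i) (M ∸ i)) (upTo M) ∎
  where
  open PermutationReasoning
  N : ℕ
  N = suc M
  blk : ℕ → List Stat
  blk k = block k (N ∸ k)
  Mid : List Stat
  Mid = concatMap blk (applyUpTo suc M)
  middle : Mid ≡ concatMap (λ i → block (suc i) (M ∸ i)) (upTo M)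
  middle = trans (cong (concatMap blk) (sym (map-upTo suc M))) (concatMap-map blk suc (upTo M))
  first : copies 1 (cartesianProductWith (glue 0 N) (Stats 0) (Stats N)) ≡ map (timesP ∘ swap) (Stats N)
  first = trans (++-identityʳ _) (++-identityʳ _)
  last : copies 1 (cartesianProductWith (glue N 0) (Stats N) (Stats 0)) ≡ Stats N
  last = trans (++-identityʳ _) (cartesianProductWith-const (Stats N) (0 , 0))

withQ-Stats-even-symmetric : ∀ h → IsSymmetric (withQ (Stats (suc (suc (h + h)))))
withQ-Stats-even-symmetric = <-rec _ step
  where
  step : ∀ h → (∀ {b} → b < h → IsSymmetric (withQ (Stats (suc (suc (b + b)))))) → IsSymmetric (withQ (Stats (suc (suc (h + h)))))
  step h IH = IsSymmetric-resp-↭ (↭-sym (withQ-Stats-even M))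
    (IsSymmetric-++ (ends-symmetric (Stats-swap-odd h)) (map-concatMap-reflect swap V M reflect))
    where
    M : ℕ
    M = h + h
    V : ℕ → List Stat
    V i = block (suc i) (M ∸ i)
    swap-block : ∀ {i} → i < M → map swap (block (suc i) (M ∸ i)) ↭ block (M ∸ i) (suc i)
    swap-block {i} i<M with parity i
    ... | even a with b , b<h , l≡ , _ ← double-∸ (halve-< {a} {h} i<M) =
      subst (λ l → map swap (block (suc (a + a)) l) ↭ block l (suc (a + a))) (sym l≡) (block-odd-even a b (IH b<h))
    ... | odd  a with b , b<h , _ , l≡ ← double-∸ (halve-suc-< {a} {h} i<M) =
      subst (λ l → map swap (block (suc (suc (a + a))) l) ↭ block l (suc (suc (a + a)))) (sym l≡)
        (↭-trans (map⁺ swap (↭-sym (block-odd-even b a (IH (halve-suc-< {a} {h} i<M))))) (↭-reflexive (map-swap-swap _)))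
    reflect : ∀ {i} → i < M → map swap (V i) ↭ V (M ∸ suc i)
    reflect {i} i<M = subst₂ (λ k l → map swap (V i) ↭ block k l)
      (+-∸-assoc 1 i<M) (sym (m∸[m∸n]≡n i<M)) (swap-block i<M)

-- Palindromicity

_≟ₛ_ : DecidableEquality Stat
_≟ₛ_ = ≡-dec _≟_ _≟_

multiplicity : Stat → List Stat → ℕ
multiplicity z X = length (filter (_≟ₛ z) X)

length-filter-map : {A B : Set} {P : B → Set} (P? : Decidable P) (f : A → B) (xs : List A) →
                    length (filter P? (map f xs)) ≡ length (filter (P? ∘ f) xs)
length-filter-map P? f []       = refl
length-filter-map P? f (x ∷ xs) with does (P? (f x))
... | true  = cong suc (length-filter-map P? f xs)
... | false = length-filter-map P? f xs

A≡multiplicity : ∀ n i j → A n i j ≡ multiplicity (i , j) (Stats n)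
A≡multiplicity n i j = begin
  length (filter (λ π → (odes π ≟ i) ×-dec (edes π ≟ j)) (Sym n)) ≡⟨ cong length (filter-≐ _ _ same (Sym n)) ⟩
  length (filter (λ π → stat π ≟ₛ (i , j)) (Sym n))               ≡⟨ length-filter-map (_≟ₛ (i , j)) stat (Sym n) ⟨
  multiplicity (i , j) (Stats n)                                   ∎
  where
  open ≡-Reasoning
  same : (λ π → odes π ≡ i × edes π ≡ j) ≐ (λ π → stat π ≡ (i , j))
  same = (λ (e₁ , e₂) → cong₂ _,_ e₁ e₂) , (λ e → cong proj₁ e , cong proj₂ e)

multiplicity-↭ : ∀ z {X Y} → X ↭ Y → multiplicity z X ≡ multiplicity z Y
multiplicity-↭ z X↭Y = ↭-length (filter-↭ (_≟ₛ z) X↭Y)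

multiplicity-++ : ∀ z X Y → multiplicity z (X ++ Y) ≡ multiplicity z X + multiplicity z Y
multiplicity-++ z X Y = trans (cong length (filter-++ (_≟ₛ z) X Y)) (length-++ (filter (_≟ₛ z) X))

multiplicity-map : ∀ (f : Stat → Stat) z z′ {X} → All (λ y → f y ≡ z ⇔ y ≡ z′) X → multiplicity z (map f X) ≡ multiplicity z′ X
multiplicity-map f z z′ {X} same = trans (length-filter-map (_≟ₛ z) f X) (go same)
  where
  go : ∀ {X} → All (λ y → f y ≡ z ⇔ y ≡ z′) X → length (filter (λ y → f y ≟ₛ z) X) ≡ multiplicity z′ X
  go {[]}    []            = refl
  go {y ∷ X} (same-y ∷ ps) with f y ≟ₛ z | y ≟ₛ z′
  ... | yes _     | yes _     = cong suc (go ps)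
  ... | no  _     | no  _     = go ps
  ... | yes fy≡z  | no  y≢z′  = ⊥-elim (y≢z′ (Equivalence.to same-y fy≡z))
  ... | no  fy≢z  | yes y≡z′  = ⊥-elim (fy≢z (Equivalence.from same-y y≡z′))

multiplicity-∈ : ∀ {z X} → z ∈ X → multiplicity z X ≢ 0
multiplicity-∈ {z} z∈X m≡0 = <-irrefl (sym m≡0) (∈-length (∈-filter⁺ (_≟ₛ z) z∈X refl))

multiplicity-∉ : ∀ {z X} → All (_≢ z) X → multiplicity z X ≡ 0
multiplicity-∉ {z} ≢z = cong length (filter-none (_≟ₛ z) ≢z)

reflect : ℕ → Stat → Stat
reflect m (a , b) = m ∸ a , m ∸ b

Bounded : ℕ → Stat → Set
Bounded m (a , b) = a ≤ m × b ≤ m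

reflect-≡ : ∀ {m i j} y → Bounded m y → i ≤ m → j ≤ m → reflect m y ≡ (i , j) ⇔ y ≡ (m ∸ i , m ∸ j)
reflect-≡ {m} (a , b) (a≤m , b≤m) i≤m j≤m = mk⇔
  (λ e → cong₂ _,_ (trans (sym (m∸[m∸n]≡n a≤m)) (cong (m ∸_) (cong proj₁ e))) (trans (sym (m∸[m∸n]≡n b≤m)) (cong (m ∸_) (cong proj₂ e))))
  (λ { refl → cong₂ _,_ (m∸[m∸n]≡n i≤m) (m∸[m∸n]≡n j≤m) })

multiset-palindromic : ∀ m (f : Poly₂) X → (∀ i j → f i j ≡ multiplicity (i , j) X) → (∃ λ y → y ∈ X) →
  IsSymmetric X → map (reflect m) X ↭ X → All (Bounded m) X → Palindromic m f
multiset-palindromic m f X f≡ (y , y∈X) sym-X refl-X bnds =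
  (proj₁ y , proj₂ y , λ fy≡0 → multiplicity-∈ y∈X (trans (sym (f≡ _ _)) fy≡0)) ,
  (λ i j → begin
    f i j
      ≡⟨ f≡ i j ⟩
    multiplicity (i , j) X
      ≡⟨ multiplicity-↭ (i , j) sym-X ⟨
    multiplicity (i , j) (map swap X)
      ≡⟨ multiplicity-map swap (i , j) (j , i) (All.universal (λ _ → mk⇔ (λ { refl → refl }) (λ { refl → refl })) X) ⟩
    multiplicity (j , i) X
      ≡⟨ f≡ j i ⟨
    f j i ∎) ,
  (λ i j i≤m j≤m → begin
    f i j
      ≡⟨ f≡ i j ⟩
    multiplicity (i , j) X
      ≡⟨ multiplicity-↭ (i , j) refl-X ⟨
    multiplicity (i , j) (map (reflect m) X)
      ≡⟨ multiplicity-map (reflect m) (i , j) _ (All.map (λ {y} b → reflect-≡ y b i≤m j≤m) bnds) ⟩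
    multiplicity (m ∸ i , m ∸ j) X
      ≡⟨ f≡ (m ∸ i) (m ∸ j) ⟨
    f (m ∸ i) (m ∸ j) ∎) ,
  (λ i j out → trans (f≡ i j) (multiplicity-∉ (All.map (outside out) bnds)))
  where
  open ≡-Reasoning
  outside : ∀ {i j y} → m < i ⊎ m < j → Bounded m y → y ≢ (i , j)
  outside (inj₁ m<i) (a≤m , _) refl = <⇒≱ m<i a≤m
  outside (inj₂ m<j) (_ , b≤m) refl = <⇒≱ m<j b≤m

Sym-nonempty : ∀ n → ∃ λ π → π ∈ Sym n
Sym-nonempty zero    = [] , here refl
Sym-nonempty (suc n) = let π , π∈ = Sym-nonempty n in
  insert 0 (suc n) π , ∈-Sym⁺ (insert-IsPermutation 0 (∈-Sym⁻ π∈))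

Stats-nonempty : ∀ n → ∃ λ y → y ∈ Stats n
Stats-nonempty n = let π , π∈ = Sym-nonempty n in stat π , ∈-map⁺ stat π∈

⊕-≡ : ∀ {x y m₁ m₂} → x ⊕ y ≡ (m₁ , m₂) → y ≡ (m₁ ∸ proj₁ x , m₂ ∸ proj₂ x) × proj₁ x ≤ m₁ × proj₂ x ≤ m₂
⊕-≡ {a , b} {c , d} refl = cong₂ _,_ (sym (m+n∸m≡n a c)) (sym (m+n∸m≡n b d)) , m≤m+n a c , m≤m+n b d

maxStat-odd : ∀ k → maxStat (suc (k + k)) ≡ (k , k)
maxStat-odd k = count-replicate-double 1 k

maxStat-even : ∀ k → maxStat (suc (suc (k + k))) ≡ (suc k , k)
maxStat-even k = cong ((1 , 0) ⊕_) (trans (count-suc 1 (replicate (k + k) true)) (cong swap (count-replicate-double 1 k)))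

complement-odd : ∀ {k π} → IsPermutation (suc (k + k)) π → stat (complement (suc (k + k)) π) ≡ reflect k (stat π) × Bounded k (stat π)
complement-odd {k} p = let c≡ , a≤ , b≤ = ⊕-≡ (trans (stat-complement p) (maxStat-odd k)) in c≡ , a≤ , b≤

complement-even : ∀ {k π} → IsPermutation (suc (suc (k + k))) π →
  stat (complement (suc (suc (k + k))) π) ≡ (suc k ∸ odes π , k ∸ edes π) × odes π ≤ suc k × edes π ≤ k
complement-even {k} p = ⊕-≡ (trans (stat-complement p) (maxStat-even k))

palindromic-odd : ∀ k → Palindromic k (A (suc (k + k)))
palindromic-odd k = multiset-palindromic k (A n) (Stats n) (A≡multiplicity n) (Stats-nonempty n) (Stats-swap-odd k)
  reflect-Stats (AllP.map⁺ (All.map (proj₂ ∘ complement-odd) (Sym-IsPermutation n)))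
  where
  n : ℕ
  n = suc (k + k)
  reflect-Stats : map (reflect k) (Stats n) ↭ Stats n
  reflect-Stats = ↭-trans (↭-reflexive (trans (sym (map-∘ (Sym n))) (map-cong-All (All.map (sym ∘ proj₁ ∘ complement-odd) (Sym-IsPermutation n)))))
                          (map-stat-complement n)

onePlusQ-A≡multiplicity : ∀ n i j → onePlusQ (A n) i j ≡ multiplicity (i , j) (withQ (Stats n))
onePlusQ-A≡multiplicity n i zero    = begin
  A n i 0
    ≡⟨ A≡multiplicity n i 0 ⟩
  multiplicity (i , 0) S
    ≡⟨ +-identityʳ _ ⟨
  multiplicity (i , 0) S + 0
    ≡⟨ cong (multiplicity (i , 0) S +_) (multiplicity-∉ (AllP.map⁺ (All.universal (λ _ ()) S))) ⟨
  multiplicity (i , 0) S + multiplicity (i , 0) (map timesQ S)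
    ≡⟨ multiplicity-++ (i , 0) S _ ⟨
  multiplicity (i , 0) (withQ S) ∎
  where
  open ≡-Reasoning
  S : List Stat
  S = Stats n
onePlusQ-A≡multiplicity n i (suc j) = begin
  A n i (suc j) + A n i j
    ≡⟨ cong₂ _+_ (A≡multiplicity n i (suc j)) (A≡multiplicity n i j) ⟩
  multiplicity (i , suc j) S + multiplicity (i , j) S
    ≡⟨ cong (multiplicity (i , suc j) S +_) (multiplicity-map timesQ (i , suc j) (i , j)
                                                                             (All.universal (λ _ → mk⇔ (λ { refl → refl }) (λ { refl → refl })) S)) ⟨
  multiplicity (i , suc j) S + multiplicity (i , suc j) (map timesQ S)
    ≡⟨ multiplicity-++ (i , suc j) S _ ⟨
  multiplicity (i , suc j) (withQ S) ∎
  where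
  open ≡-Reasoning
  S : List Stat
  S = Stats n

reflect-withQ-Stats-even : ∀ k → map (reflect (suc k)) (withQ (Stats (suc (suc (k + k))))) ↭ withQ (Stats (suc (suc (k + k))))
reflect-withQ-Stats-even k = begin
  map (reflect (suc k)) (S ++ map timesQ S)
    ≡⟨ map-++ (reflect (suc k)) S _ ⟩
  map (reflect (suc k)) S ++ map (reflect (suc k)) (map timesQ S)
    ≡⟨ cong₂ _++_
      (trans (sym (map-∘ (Sym n))) (trans (map-cong-All (All.map reflect-stat perms)) (map-∘ (Sym n))))
      (trans (sym (map-∘ S)) (trans (sym (map-∘ (Sym n))) (map-cong-All (All.map (sym ∘ proj₁ ∘ complement-even) perms)))) ⟩
  map timesQ (map (stat ∘ complement n) (Sym n)) ++ map (stat ∘ complement n) (Sym n)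
    ↭⟨ ++⁺ (map⁺ timesQ (map-stat-complement n)) (map-stat-complement n) ⟩
  map timesQ S ++ S
    ↭⟨ ++-comm (map timesQ S) S ⟩
  withQ S ∎
  where
  open PermutationReasoning
  n : ℕ
  n = suc (suc (k + k))
  S : List Stat
  S = Stats n
  perms : All (IsPermutation n) (Sym n)
  perms = Sym-IsPermutation n
  reflect-stat : ∀ {π} → IsPermutation n π → reflect (suc k) (stat π) ≡ timesQ (stat (complement n π))
  reflect-stat {π} p with c≡ , _ , b≤ ← complement-even p = trans (cong (suc k ∸ odes π ,_) (+-∸-assoc 1 b≤)) (cong timesQ (sym c≡))

palindromic-even : ∀ k → Palindromic (suc k) (onePlusQ (A (suc (suc (k + k)))))
palindromic-even k = multiset-palindromic (suc k) (onePlusQ (A n)) (withQ (Stats n)) (onePlusQ-A≡multiplicity n)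
  (proj₁ (Stats-nonempty n) , ∈-++⁺ˡ (proj₂ (Stats-nonempty n))) (withQ-Stats-even-symmetric k) (reflect-withQ-Stats-even k)
  (AllP.++⁺ (AllP.map⁺ (All.map (λ p → let _ , a≤ , b≤ = complement-even p in a≤ , m≤n⇒m≤1+n b≤) perms))
            (AllP.map⁺ (AllP.map⁺ (All.map (λ p → let _ , a≤ , b≤ = complement-even p in a≤ , s≤s b≤) perms))))
  where
  n : ℕ
  n = suc (suc (k + k))
  perms : All (IsPermutation n) (Sym n)
  perms = Sym-IsPermutation n

isOdd-double : ∀ k → isOdd (k + k) ≡ false
isOdd-double zero    = refl
isOdd-double (suc k) = trans (cong (isOdd ∘ suc) (+-suc k k)) (isOdd-double k)

isOdd-suc-double : ∀ k → isOdd (suc (k + k)) ≡ true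
isOdd-suc-double zero    = refl
isOdd-suc-double (suc k) = trans (cong isOdd (+-suc k k)) (isOdd-suc-double k)

Ã-odd : ∀ k → Ã (suc (k + k)) ≡ A (suc (k + k))
Ã-odd k = cong (λ b → if b then A (suc (k + k)) else onePlusQ (A (suc (k + k)))) (isOdd-suc-double k)

Ã-even : ∀ k → Ã (suc (suc (k + k))) ≡ onePlusQ (A (suc (suc (k + k))))
Ã-even k = cong (λ b → if b then A (suc (suc (k + k))) else onePlusQ (A (suc (suc (k + k))))) (isOdd-double k)

suc-double/2 : ∀ k → suc (k + k) / 2 ≡ k
suc-double/2 zero    = refl
suc-double/2 (suc k) = trans (cong (λ t → suc (suc t) / 2) (+-suc k k))
  (trans (m/n≡1+[m∸n]/n {suc (suc (suc (k + k)))} {2} (s≤s (s≤s z≤n))) (cong suc (suc-double/2 k)))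

suc-suc-double/2 : ∀ k → suc (suc (k + k)) / 2 ≡ suc k
suc-suc-double/2 zero    = refl
suc-suc-double/2 (suc k) = trans (cong (λ t → suc (suc (suc t)) / 2) (+-suc k k))
  (trans (m/n≡1+[m∸n]/n {suc (suc (suc (suc (k + k))))} {2} (s≤s (s≤s z≤n))) (cong suc (suc-suc-double/2 k)))

theorem1p1 : ∀ (n : ℕ) → Palindromic (suc n / 2) (Ã (suc n))
theorem1p1 n with parity n
... | even k = subst₂ Palindromic (sym (suc-double/2 k)) (sym (Ã-odd k)) (palindromic-odd k)
... | odd  k = subst₂ Palindromic (sym (suc-suc-double/2 k)) (sym (Ã-even k)) (palindromic-even k)
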